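{- Let $G$ be a simple connected graph with $|E(G)|\ge4$ and let $v\in V(G)$. Let $\bar G$ be obtained from $G$ by attaching three new pendant vertices $a,b,c$ to $v$, let $\widetilde G=\bar G+\{a,b\}$, and let $G^*=\bar G+\{a,b\}+\{b,c\}+\{a,c\}$. Then $\mathscr{K}(G^*)>\mathscr{K}(\widetilde G)$.
   Context: For connected $H$ with $m\ge1$ edges and degrees $d_i$, Kemeny's constant is $\mathscr{K}(H)=\sum_j\pi_jm_{ij}$ for the simple random walk on $H$ ($\pi_j=d_j/2m$, $m_{ij}$ expected hitting time of $j$ from $i$, $m_{jj}=0$), equivalently $\frac1{4m}\sum_{i,j}d_id_jr_H(i,j)$ with $r_H$ effective resistance. $H+\{x,y\}$ denotes $H$ with the edge $\{x,y\}$ added. -}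

module Defs where

open import Data.Nat as ℕ using (ℕ; zero; suc; _<ᵇ_)
open import Data.Integer using (+_)
open import Data.Rational as ℚ using (ℚ; 0ℚ; 1ℚ; _/_)
open import Data.Fin using (Fin; zero; suc; toℕ; splitAt; _≟_)
open import Data.Bool using (Bool; true; false; if_then_else_; _∧_)
open import Data.Sum using (_⊎_; inj₁; inj₂)
open import Data.Product using (_×_)
open import Relation.Nullary using (¬_)
open import Relation.Nullary.Decidable using (⌊_⌋)
open import Relation.Binary.PropositionalEquality using (_≡_)

Σℕ : ∀ {N} → (Fin N → ℕ) → ℕ
Σℕ {zero} f = 0
Σℕ {suc N} f = f zero ℕ.+ Σℕ (λ i → f (suc i))

Σℚ : ∀ {N} → (Fin N → ℚ) → ℚ
Σℚ {zero} f = 0ℚ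
Σℚ {suc N} f = f zero ℚ.+ Σℚ (λ i → f (suc i))

Adj : ℕ → Set
Adj N = Fin N → Fin N → Bool

record SimpleGraph (n : ℕ) : Set where
  field
    adj    : Adj n
    sym    : ∀ i j → adj i j ≡ adj j i
    irrefl : ∀ i → adj i i ≡ false
open SimpleGraph public

data Walk {N} (A : Adj N) : Fin N → Fin N → Set where
  here : ∀ {i} → Walk A i i
  step : ∀ {i j k} → A i j ≡ true → Walk A j k → Walk A i k

Connected : ∀ {N} → Adj N → Set
Connected {N} A = ∀ (i j : Fin N) → Walk A i j

edgeCount : ∀ {N} → Adj N → ℕ
edgeCount A = Σℕ (λ i → Σℕ (λ j → if A i j ∧ (toℕ i <ᵇ toℕ j) then 1 else 0))

degree : ∀ {N} → Adj N → Fin N → ℕ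
degree A i = Σℕ (λ j → if A i j then 1 else 0)

-- Attach three new vertices a,b,c (= the Fin 3 part of Fin (3 + n):
-- a = 0, b = 1, c = 2) to v, each joined to v, and with the edges among
-- {a,b,c} given by E.
attach : ∀ {n} → Adj n → Fin n → Adj 3 → Adj (3 ℕ.+ n)
attach {n} A v E x y with splitAt 3 x | splitAt 3 y
... | inj₁ p | inj₁ q = E p q
... | inj₁ p | inj₂ j = ⌊ j ≟ v ⌋
... | inj₂ i | inj₁ q = ⌊ i ≟ v ⌋
... | inj₂ i | inj₂ j = A i j

a b c : Fin 3
a = zero
b = suc zero
c = suc (suc zero)

abEdge : Adj 3
abEdge zero (suc zero) = true
abEdge (suc zero) zero = true
abEdge _ _ = false

triangle : Adj 3
triangle zero zero = false
triangle (suc zero) (suc zero) = false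
triangle (suc (suc zero)) (suc (suc zero)) = false
triangle _ _ = true

Gtilde : ∀ {n} → SimpleGraph n → Fin n → Adj (3 ℕ.+ n)
Gtilde G v = attach (adj G) v abEdge

Gstar : ∀ {n} → SimpleGraph n → Fin n → Adj (3 ℕ.+ n)
Gstar G v = attach (adj G) v triangle

-- m is the matrix of expected hitting times of the simple random walk on A:
-- m j j = 0, and for i ≠ j: m i j = 1 + (1/d_i) Σ_{k ~ i} m k j
-- (written multiplied through by d_i).
IsHittingTimes : ∀ {N} → Adj N → (Fin N → Fin N → ℚ) → Set
IsHittingTimes {N} A m = ∀ (i j : Fin N) →
  (i ≡ j → m i j ≡ 0ℚ) ×
  (¬ (i ≡ j) →
     ((+ degree A i) / 1) ℚ.* m i j
       ≡ ((+ degree A i) / 1) ℚ.+ Σℚ (λ k → if A i k then m k j else 0ℚ))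

totalDegree : ∀ {N} → Adj N → ℕ
totalDegree A = Σℕ (degree A)

stationary : ∀ {N} → Adj N → Fin N → ℚ
stationary A j with totalDegree A
... | zero  = 0ℚ
... | suc k = (+ degree A j) / suc k

kemeny : ∀ {N} → Adj N → (Fin N → Fin N → ℚ) → Fin N → ℚ
kemeny A m i = Σℚ (λ j → stationary A j ℚ.* m i j)

-- Hitting times to a target j are the solutions of Δ F = deg away from j with F j = 0, where Δ
-- is the graph Laplacian. A maximum principle makes them unique and nonnegative; as Σ Δ F = 0,
-- Kac's formula gives Δ F j = deg j - vol, so Σⱼ deg j · m i j is harmonic, hence independent
-- of i, and it equals vol times Kemeny's constant. Existence follows by eliminating the vertices
-- one at a time.
--
-- When three new vertices are attached at v, the hitting times between old vertices become
-- h i j + κ (h i j + h j v - h i v), with h those of G and κ · vol G the mean length of an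
-- excursion through the new vertices, and the hitting times to and from the new vertices are
-- affine in W = vol G. Both Kemeny constants are thereby explicit in W, Σⱼ deg j · h v j and
-- Σⱼ deg j · h j v ≥ 0, and their difference is positive once W ≥ 8, i.e. once G has four edges.

module Submission where

open import Algebra.Bundles using (CommutativeRing)
open import Data.Bool using (Bool; true; false; if_then_else_; _∧_)
import Data.Bool as Bool
open import Data.Bool.Properties using (T-≡; ¬-not; ∧-identityʳ; ∧-zeroʳ)
open import Data.Fin using (Fin; zero; suc; toℕ; punchIn; punchOut; _↑ˡ_; _↑ʳ_; splitAt; _≟_)
open import Data.Fin.Properties using (punchInᵢ≢i; punchIn-punchOut; punchOut-punchIn; punchOut-cong; splitAt-↑ˡ; toℕ-injective; all?)
import Data.Integer as ℤ
import Data.Integer.Properties as ℤ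
import Data.Nat.Properties as ℕ
open import Data.Nat as ℕ using (ℕ; zero; suc; _<ᵇ_)
open import Data.Product using (_×_; _,_; ∃; proj₁; proj₂)
open import Data.Sum using (inj₁; inj₂)
open import Data.Rational using (ℚ; 0ℚ; 1ℚ; _+_; _*_; -_; _-_; _/_; 1/_; _≤_; _<_; NonZero; Positive; nonNegative; positive; toℚᵘ)
open import Data.Rational.Properties hiding (_≟_)
import Data.Rational.Properties as ℚ using (_≟_)
import Data.Rational.Unnormalised as ℚᵘ
import Data.Rational.Unnormalised.Properties as ℚᵘ
open import Data.Vec.Functional using (replicate)
open import Function using (_∘_; _⇔_; mk⇔; Equivalence)
open import Level using (0ℓ)
open import Relation.Binary using (tri<; tri≈; tri>)
open import Relation.Binary.PropositionalEquality
open import Relation.Nullary using (¬_; yes; no; contradiction)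
open import Relation.Nullary.Decidable using (dec⇒maybe; ⌊_⌋; True; toWitness; ¬?; _→-dec_)
open import Tactic.RingSolver using (solve-∀)
open import Tactic.RingSolver.Core.AlmostCommutativeRing using (AlmostCommutativeRing; fromCommutativeRing)

open import Algebra.Properties.Semiring.Sum (CommutativeRing.semiring +-*-commutativeRing)
  using (sum; sum-cong-≗; ∑-distrib-+; ∑-comm; *-distribˡ-sum; *-distribʳ-sum; sum-remove; sum-replicate-zero)

open import Defs hiding (sym; a; b; c)

-- Rationals and finite sums

ℚ-ring : AlmostCommutativeRing 0ℓ 0ℓ
ℚ-ring = fromCommutativeRing +-*-commutativeRing (λ x → dec⇒maybe (0ℚ ℚ.≟ x))

toℚ : ℕ → ℚ
toℚ n = ℤ.+ n / 1

toℚᵘ-toℚ : ∀ n → toℚᵘ (toℚ n) ℚᵘ.≃ ℚᵘ.mkℚᵘ (ℤ.+ n) 0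
toℚᵘ-toℚ n = toℚᵘ-fromℚᵘ (ℚᵘ.mkℚᵘ (ℤ.+ n) 0)

toℚ-+ : ∀ m n → toℚ (m ℕ.+ n) ≡ toℚ m + toℚ n
toℚ-+ m n = toℚᵘ-injective (begin
  toℚᵘ (toℚ (m ℕ.+ n))
    ≈⟨ toℚᵘ-toℚ (m ℕ.+ n) ⟩
  ℚᵘ.mkℚᵘ (ℤ.+ m ℤ.+ ℤ.+ n) 0
    ≈⟨ ℚᵘ.*≡* (cong (ℤ._* ℤ.+ 1) (cong₂ ℤ._+_ (ℤ.*-identityʳ (ℤ.+ m)) (ℤ.*-identityʳ (ℤ.+ n)))) ⟨
  ℚᵘ.mkℚᵘ (ℤ.+ m) 0 ℚᵘ.+ ℚᵘ.mkℚᵘ (ℤ.+ n) 0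
    ≈⟨ ℚᵘ.+-cong (toℚᵘ-toℚ m) (toℚᵘ-toℚ n) ⟨
  toℚᵘ (toℚ m) ℚᵘ.+ toℚᵘ (toℚ n)
    ≈⟨ toℚᵘ-homo-+ (toℚ m) (toℚ n) ⟨
  toℚᵘ (toℚ m + toℚ n) ∎)
  where open ℚᵘ.≃-Reasoning

/-*-cancel : ∀ d k → (ℤ.+ d / suc k) * toℚ (suc k) ≡ toℚ d
/-*-cancel d k = toℚᵘ-injective (begin
  toℚᵘ ((ℤ.+ d / suc k) * toℚ (suc k))
    ≈⟨ toℚᵘ-homo-* (ℤ.+ d / suc k) (toℚ (suc k)) ⟩
  toℚᵘ (ℤ.+ d / suc k) ℚᵘ.* toℚᵘ (toℚ (suc k))
    ≈⟨ ℚᵘ.*-cong (toℚᵘ-fromℚᵘ (ℚᵘ.mkℚᵘ (ℤ.+ d) k)) (toℚᵘ-toℚ (suc k)) ⟩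
  ℚᵘ.mkℚᵘ (ℤ.+ d) k ℚᵘ.* ℚᵘ.mkℚᵘ (ℤ.+ suc k) 0
    ≈⟨ ℚᵘ.*≡* (ℤ.*-assoc (ℤ.+ d) (ℤ.+ suc k) (ℤ.+ 1)) ⟩
  ℚᵘ.mkℚᵘ (ℤ.+ d) 0
    ≈⟨ toℚᵘ-toℚ d ⟨
  toℚᵘ (toℚ d) ∎)
  where open ℚᵘ.≃-Reasoning

toℚ-nonNeg : ∀ n → 0ℚ ≤ toℚ n
toℚ-nonNeg n = nonNegative⁻¹ (toℚ n) {{normalize-nonNeg n 1}}

p≤q⇒0≤q-p : ∀ {p q} → p ≤ q → 0ℚ ≤ q - p
p≤q⇒0≤q-p {p} {q} p≤q = subst (_≤ q - p) (+-inverseʳ p) (+-monoˡ-≤ (- p) p≤q)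

p-q≤0⇒p≤q : ∀ {p q} → p - q ≤ 0ℚ → p ≤ q
p-q≤0⇒p≤q {p} {q} p-q≤0 = subst₂ _≤_ (cancel p q) (+-identityˡ q) (+-monoˡ-≤ q p-q≤0)
  where
  cancel : ∀ p q → p - q + q ≡ p
  cancel = solve-∀ ℚ-ring

0<q-p⇒p<q : ∀ {p q} → 0ℚ < q - p → p < q
0<q-p⇒p<q {p} {q} 0<q-p = subst₂ _<_ (+-identityˡ p) (cancel q p) (+-monoˡ-< p 0<q-p)
  where
  cancel : ∀ q p → q - p + p ≡ q
  cancel = solve-∀ ℚ-ring

*-nonNeg : ∀ {p q} → 0ℚ ≤ p → 0ℚ ≤ q → 0ℚ ≤ p * q
*-nonNeg {p} {q} 0≤p 0≤q = nonNegative⁻¹ _ {{nonNeg*nonNeg⇒nonNeg p {{nonNegative 0≤p}} q {{nonNegative 0≤q}}}}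

*-pos : ∀ {p q} → 0ℚ < p → 0ℚ < q → 0ℚ < p * q
*-pos {p} {q} 0<p 0<q = positive⁻¹ _ {{pos*pos⇒pos p {{positive 0<p}} q {{positive 0<q}}}}

Σℚ≡sum : ∀ {N} (f : Fin N → ℚ) → Σℚ f ≡ sum f
Σℚ≡sum {zero} f = refl
Σℚ≡sum {suc N} f = cong (f zero +_) (Σℚ≡sum (f ∘ suc))

toℚ-Σℕ : ∀ {N} (f : Fin N → ℕ) → toℚ (Σℕ f) ≡ sum (λ i → toℚ (f i))
toℚ-Σℕ {zero} f = refl
toℚ-Σℕ {suc N} f = trans (toℚ-+ (f zero) (Σℕ (f ∘ suc))) (cong (toℚ (f zero) +_) (toℚ-Σℕ (f ∘ suc)))

∑-distrib-- : ∀ {N} (f g : Fin N → ℚ) → sum (λ i → f i - g i) ≡ sum f - sum g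
∑-distrib-- {zero} f g = refl
∑-distrib-- {suc N} f g =
  trans (cong (f zero - g zero +_) (∑-distrib-- (f ∘ suc) (g ∘ suc)))
        (interchange (f zero) (g zero) (sum (f ∘ suc)) (sum (g ∘ suc)))
  where
  interchange : ∀ a b c d → a - b + (c - d) ≡ a + c - (b + d)
  interchange = solve-∀ ℚ-ring

∑-affine : ∀ {N} (a b : Fin N → ℚ) W → sum (λ r → a r + b r * W) ≡ sum a + sum b * W
∑-affine a b W = trans (∑-distrib-+ a (λ r → b r * W)) (cong (sum a +_) (sym (*-distribʳ-sum W b)))

sum-nonNeg : ∀ {N} (f : Fin N → ℚ) → (∀ i → 0ℚ ≤ f i) → 0ℚ ≤ sum f
sum-nonNeg {zero} f _ = ≤-refl
sum-nonNeg {suc N} f 0≤f = +-mono-≤ (0≤f zero) (sum-nonNeg (f ∘ suc) (0≤f ∘ suc))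

≤-sum : ∀ {N} (f : Fin N → ℚ) → (∀ i → 0ℚ ≤ f i) → ∀ i → f i ≤ sum f
≤-sum {suc N} f 0≤f i = begin
  f i                                   ≤⟨ p≤p+q (sum-nonNeg _ (λ k → 0≤f (punchIn i k))) ⟩
  f i + sum (λ k → f (punchIn i k))     ≡⟨ sum-remove {i = i} f ⟨
  sum f                                 ∎
  where
  open ≤-Reasoning
  p≤p+q : ∀ {p q} → 0ℚ ≤ q → p ≤ p + q
  p≤p+q {p} 0≤q = subst (_≤ p + _) (+-identityʳ p) (+-monoʳ-≤ p 0≤q)

𝟙 : Bool → ℚ
𝟙 true = 1ℚ
𝟙 false = 0ℚ

𝟙-nonNeg : ∀ b → 0ℚ ≤ 𝟙 b
𝟙-nonNeg true = nonNegative⁻¹ 1ℚ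
𝟙-nonNeg false = ≤-refl

δ : ∀ {N} → Fin N → Fin N → ℚ
δ i j = 𝟙 ⌊ i ≟ j ⌋

δ-refl : ∀ {N} (i : Fin N) → δ i i ≡ 1ℚ
δ-refl i with i ≟ i
... | yes _ = refl
... | no i≢i = contradiction refl i≢i

δ-≢ : ∀ {N} {i j : Fin N} → i ≢ j → δ i j ≡ 0ℚ
δ-≢ {i = i} {j} i≢j with i ≟ j
... | yes i≡j = contradiction i≡j i≢j
... | no _ = refl

δ-sym : ∀ {N} (i j : Fin N) → δ i j ≡ δ j i
δ-sym i j with i ≟ j | j ≟ i
... | yes _    | yes _    = refl
... | no _     | no _     = refl
... | yes i≡j  | no j≢i   = contradiction (sym i≡j) j≢i
... | no i≢j   | yes j≡i  = contradiction (sym j≡i) i≢j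

∑-δ : ∀ {N} (v : Fin N) (F : Fin N → ℚ) → sum (λ k → δ k v * F k) ≡ F v
∑-δ {suc N} v F = begin
  sum (λ k → δ k v * F k)
    ≡⟨ sum-remove {i = v} (λ k → δ k v * F k) ⟩
  δ v v * F v + sum (λ k → δ (punchIn v k) v * F (punchIn v k))
    ≡⟨ cong₂ _+_ (cong (_* F v) (δ-refl v)) (sum-cong-≗ off-v) ⟩
  1ℚ * F v + sum (replicate N 0ℚ)
    ≡⟨ cong₂ _+_ (*-identityˡ (F v)) (sum-replicate-zero N) ⟩
  F v + 0ℚ
    ≡⟨ +-identityʳ (F v) ⟩
  F v ∎
  where
  open ≡-Reasoning
  off-v : ∀ k → δ (punchIn v k) v * F (punchIn v k) ≡ 0ℚ
  off-v k = trans (cong (_* F (punchIn v k)) (δ-≢ (punchInᵢ≢i v k))) (*-zeroˡ (F (punchIn v k)))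

∑-point-mass : ∀ {N} (v : Fin N) (c : ℚ) (g F : Fin N → ℚ) →
               sum (λ i → (c * δ i v + g i) * F i) ≡ c * F v + sum (λ i → g i * F i)
∑-point-mass v c g F = begin
  sum (λ i → (c * δ i v + g i) * F i)
    ≡⟨ sum-cong-≗ (λ i → distrib c (δ i v) (g i) (F i)) ⟩
  sum (λ i → δ i v * (c * F i) + g i * F i)
    ≡⟨ ∑-distrib-+ (λ i → δ i v * (c * F i)) (λ i → g i * F i) ⟩
  sum (λ i → δ i v * (c * F i)) + sum (λ i → g i * F i)
    ≡⟨ cong (_+ sum (λ i → g i * F i)) (∑-δ v (λ i → c * F i)) ⟩
  c * F v + sum (λ i → g i * F i) ∎
  where
  open ≡-Reasoning
  distrib : ∀ c e g f → (c * e + g) * f ≡ e * (c * f) + g * f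
  distrib = solve-∀ ℚ-ring

-- Graph Laplacians

Weights : ℕ → Set
Weights N = Fin N → Fin N → ℚ

⟦_⟧ : ∀ {N} → Adj N → Weights N
⟦ A ⟧ i k = 𝟙 (A i k)

Δ : ∀ {N} → Weights N → (Fin N → ℚ) → Fin N → ℚ
Δ w f i = sum (λ k → w i k * (f i - f k))

deg : ∀ {N} → Adj N → Fin N → ℚ
deg A i = sum (⟦ A ⟧ i)

vol : ∀ {N} → Adj N → ℚ
vol A = sum (deg A)

IsSymmetric : ∀ {N} → Adj N → Set
IsSymmetric A = ∀ i j → A i j ≡ A j i

deg-nonNeg : ∀ {N} (A : Adj N) i → 0ℚ ≤ deg A i
deg-nonNeg A i = sum-nonNeg _ (λ k → 𝟙-nonNeg (A i k))

∑-weighted-differences : ∀ {N} (a g : Fin N → ℚ) x →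
                         sum (λ k → a k * (x - g k)) ≡ sum a * x - sum (λ k → a k * g k)
∑-weighted-differences a g x = begin
  sum (λ k → a k * (x - g k))                   ≡⟨ sum-cong-≗ (λ k → distrib (a k) x (g k)) ⟩
  sum (λ k → x * a k - a k * g k)               ≡⟨ ∑-distrib-- (λ k → x * a k) (λ k → a k * g k) ⟩
  sum (λ k → x * a k) - sum (λ k → a k * g k)   ≡⟨ cong (_- sum (λ k → a k * g k)) (*-distribˡ-sum x a) ⟨
  x * sum a - sum (λ k → a k * g k)             ≡⟨ cong (_- sum (λ k → a k * g k)) (*-comm x (sum a)) ⟩
  sum a * x - sum (λ k → a k * g k)             ∎
  where
  open ≡-Reasoning
  distrib : ∀ a x y → a * (x - y) ≡ x * a - a * y
  distrib = solve-∀ ℚ-ring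

Δ-expand : ∀ {N} (w : Weights N) f i → Δ w f i ≡ sum (w i) * f i - sum (λ k → w i k * f k)
Δ-expand w f i = ∑-weighted-differences (w i) f (f i)

Δ-cong : ∀ {N} (w : Weights N) {f g : Fin N → ℚ} → (∀ k → f k ≡ g k) → ∀ i → Δ w f i ≡ Δ w g i
Δ-cong w f≗g i = sum-cong-≗ (λ k → cong₂ (λ x y → w i k * (x - y)) (f≗g i) (f≗g k))

Δ-shift : ∀ {N} (w : Weights N) (f : Fin N → ℚ) c i → Δ w (λ k → f k + c) i ≡ Δ w f i
Δ-shift w f c i = sum-cong-≗ (λ k → cong (w i k *_) (cancel (f i) (f k) c))
  where
  cancel : ∀ x y c → x + c - (y + c) ≡ x - y
  cancel = solve-∀ ℚ-ring

Δ-lincomb : ∀ {N} (w : Weights N) (h f g : Fin N → ℚ) a b c → (∀ k → h k ≡ a * f k + b * g k + c) →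
            ∀ i → Δ w h i ≡ a * Δ w f i + b * Δ w g i
Δ-lincomb w h f g a b c h≡ i = begin
  sum (λ k → w i k * (h i - h k))
    ≡⟨ sum-cong-≗ term ⟩
  sum (λ k → a * (w i k * (f i - f k)) + b * (w i k * (g i - g k)))
    ≡⟨ ∑-distrib-+ (λ k → a * (w i k * (f i - f k))) (λ k → b * (w i k * (g i - g k))) ⟩
  sum (λ k → a * (w i k * (f i - f k))) + sum (λ k → b * (w i k * (g i - g k)))
    ≡⟨ cong₂ _+_ (*-distribˡ-sum a (λ k → w i k * (f i - f k))) (*-distribˡ-sum b (λ k → w i k * (g i - g k))) ⟨
  a * Δ w f i + b * Δ w g i ∎
  where
  open ≡-Reasoning
  expand : ∀ a b c x fi fk gi gk →
           x * ((a * fi + b * gi + c) - (a * fk + b * gk + c)) ≡ a * (x * (fi - fk)) + b * (x * (gi - gk))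
  expand = solve-∀ ℚ-ring
  term : ∀ k → w i k * (h i - h k) ≡ a * (w i k * (f i - f k)) + b * (w i k * (g i - g k))
  term k = trans (cong₂ (λ x y → w i k * (x - y)) (h≡ i) (h≡ k)) (expand a b c (w i k) (f i) (f k) (g i) (g k))

Δ-∑ : ∀ {N M} (w : Weights N) (c : Fin M → ℚ) (F : Fin M → Fin N → ℚ) i →
      Δ w (λ k → sum (λ j → c j * F j k)) i ≡ sum (λ j → c j * Δ w (F j) i)
Δ-∑ w c F i = begin
  sum (λ k → w i k * (sum (λ j → c j * F j i) - sum (λ j → c j * F j k)))
    ≡⟨ sum-cong-≗ inner ⟩
  sum (λ k → sum (λ j → c j * (w i k * (F j i - F j k))))
    ≡⟨ ∑-comm (λ k j → c j * (w i k * (F j i - F j k))) ⟩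
  sum (λ j → sum (λ k → c j * (w i k * (F j i - F j k))))
    ≡⟨ sum-cong-≗ (λ j → *-distribˡ-sum (c j) (λ k → w i k * (F j i - F j k))) ⟨
  sum (λ j → c j * Δ w (F j) i) ∎
  where
  open ≡-Reasoning
  regroup : ∀ x c fi fk → x * (c * fi - c * fk) ≡ c * (x * (fi - fk))
  regroup = solve-∀ ℚ-ring
  inner : ∀ k → w i k * (sum (λ j → c j * F j i) - sum (λ j → c j * F j k))
                ≡ sum (λ j → c j * (w i k * (F j i - F j k)))
  inner k = begin
    w i k * (sum (λ j → c j * F j i) - sum (λ j → c j * F j k))
      ≡⟨ cong (w i k *_) (∑-distrib-- (λ j → c j * F j i) (λ j → c j * F j k)) ⟨
    w i k * sum (λ j → c j * F j i - c j * F j k)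
      ≡⟨ *-distribˡ-sum (w i k) (λ j → c j * F j i - c j * F j k) ⟩
    sum (λ j → w i k * (c j * F j i - c j * F j k))
      ≡⟨ sum-cong-≗ (λ j → regroup (w i k) (c j) (F j i) (F j k)) ⟩
    sum (λ j → c j * (w i k * (F j i - F j k))) ∎

∑-Δ≡0 : ∀ {N} (A : Adj N) → IsSymmetric A → ∀ f → sum (Δ ⟦ A ⟧ f) ≡ 0ℚ
∑-Δ≡0 A sym f = begin
  sum (λ i → sum (λ k → ⟦ A ⟧ i k * (f i - f k)))
    ≡⟨ sum-cong-≗ split ⟩
  sum (λ i → out i - sum (λ k → ⟦ A ⟧ i k * f k))
    ≡⟨ ∑-distrib-- out _ ⟩
  sum out - sum (λ i → sum (λ k → ⟦ A ⟧ i k * f k))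
    ≡⟨ cong (λ s → sum out - s) (∑-comm (λ i k → ⟦ A ⟧ i k * f k)) ⟩
  sum out - sum (λ k → sum (λ i → ⟦ A ⟧ i k * f k))
    ≡⟨ cong (λ s → sum out - s) (sum-cong-≗ (λ k → sum-cong-≗ (λ i → cong (λ b → 𝟙 b * f k) (sym i k)))) ⟩
  sum out - sum out
    ≡⟨ +-inverseʳ (sum out) ⟩
  0ℚ ∎
  where
  open ≡-Reasoning
  out : _ → ℚ
  out i = sum (λ k → ⟦ A ⟧ i k * f i)
  distrib : ∀ a x y → a * (x - y) ≡ a * x - a * y
  distrib = solve-∀ ℚ-ring
  split : ∀ i → sum (λ k → ⟦ A ⟧ i k * (f i - f k)) ≡ out i - sum (λ k → ⟦ A ⟧ i k * f k)
  split i = trans (sum-cong-≗ (λ k → distrib (⟦ A ⟧ i k) (f i) (f k)))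
                  (∑-distrib-- (λ k → ⟦ A ⟧ i k * f i) (λ k → ⟦ A ⟧ i k * f k))

-- The maximum principle and hitting times

argmax : ∀ {N} (f : Fin (suc N) → ℚ) → ∃ λ i → ∀ k → f k ≤ f i
argmax {zero} f = zero , λ { zero → ≤-refl }
argmax {suc N} f with argmax (f ∘ suc)
... | i , max with f zero ≤? f (suc i)
...   | yes f0≤ = suc i , λ { zero → f0≤ ; (suc k) → max k }
...   | no f0≰ = zero , λ { zero → ≤-refl ; (suc k) → ≤-trans (max k) (<⇒≤ (≰⇒> f0≰)) }

maximum-at-neighbour : ∀ {N} (A : Adj N) (f : Fin N → ℚ) {x y} → (∀ k → f k ≤ f x) →
                       Δ ⟦ A ⟧ f x ≤ 0ℚ → A x y ≡ true → f x ≤ f y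
maximum-at-neighbour A f {x} {y} max Δ≤0 Axy = p-q≤0⇒p≤q (begin
  f x - f y                     ≡⟨ *-identityˡ (f x - f y) ⟨
  1ℚ * (f x - f y)              ≡⟨ cong (λ b → 𝟙 b * (f x - f y)) Axy ⟨
  ⟦ A ⟧ x y * (f x - f y)       ≤⟨ ≤-sum _ term≥0 y ⟩
  Δ ⟦ A ⟧ f x                   ≤⟨ Δ≤0 ⟩
  0ℚ                            ∎)
  where
  open ≤-Reasoning
  term≥0 : ∀ k → 0ℚ ≤ ⟦ A ⟧ x k * (f x - f k)
  term≥0 k = *-nonNeg (𝟙-nonNeg (A x k)) (p≤q⇒0≤q-p (max k))

maximum-principle : ∀ {N} (A : Adj N) (f : Fin N → ℚ) {j} → (∀ i → Walk A i j) →
                    (∀ x → x ≢ j → Δ ⟦ A ⟧ f x ≤ 0ℚ) → ∀ i → f i ≤ f j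
maximum-principle {suc N} A f {j} walks Δ≤0 i with argmax f
... | i₀ , max = ≤-trans (max i) (along (walks i₀) ≤-refl)
  where
  along : ∀ {x} → Walk A x j → f i₀ ≤ f x → f i₀ ≤ f j
  along here fi₀≤fx = fi₀≤fx
  along (step {i = x} Axy rest) fi₀≤fx with x ≟ j
  ... | yes refl = fi₀≤fx
  ... | no x≢j = along rest (≤-trans fi₀≤fx
                   (maximum-at-neighbour A f (λ k → ≤-trans (max k) fi₀≤fx) (Δ≤0 x x≢j) Axy))

record IsHittingColumn {N} (A : Adj N) (j : Fin N) (F : Fin N → ℚ) : Set where
  field
    at-target  : F j ≡ 0ℚ
    off-target : ∀ x → x ≢ j → Δ ⟦ A ⟧ F x ≡ deg A x
open IsHittingColumn

IsHittingMatrix : ∀ {N} → Adj N → (Fin N → Fin N → ℚ) → Set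
IsHittingMatrix A m = ∀ j → IsHittingColumn A j (λ i → m i j)

module _ {N} {A : Adj N} {j : Fin N} (walks : ∀ i → Walk A i j) where

  hitting-≤ : ∀ {F G} → IsHittingColumn A j F → IsHittingColumn A j G → ∀ i → F i ≤ G i
  hitting-≤ {F} {G} F-hit G-hit i = p-q≤0⇒p≤q (begin
    F i - G i   ≤⟨ maximum-principle A (λ k → F k - G k) walks Δ≤0 i ⟩
    F j - G j   ≡⟨ cong₂ _-_ (at-target F-hit) (at-target G-hit) ⟩
    0ℚ          ∎)
    where
    open ≤-Reasoning
    as-lincomb : ∀ x y → x - y ≡ 1ℚ * x + (- 1ℚ) * y + 0ℚ
    as-lincomb = solve-∀ ℚ-ring
    cancel : ∀ d → 1ℚ * d + (- 1ℚ) * d ≡ 0ℚ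
    cancel = solve-∀ ℚ-ring
    Δ≤0 : ∀ x → x ≢ j → Δ ⟦ A ⟧ (λ k → F k - G k) x ≤ 0ℚ
    Δ≤0 x x≢j = ≤-reflexive (begin-equality
      Δ ⟦ A ⟧ (λ k → F k - G k) x
        ≡⟨ Δ-lincomb ⟦ A ⟧ (λ k → F k - G k) F G 1ℚ (- 1ℚ) 0ℚ (λ k → as-lincomb (F k) (G k)) x ⟩
      1ℚ * Δ ⟦ A ⟧ F x + (- 1ℚ) * Δ ⟦ A ⟧ G x
        ≡⟨ cong₂ (λ p q → 1ℚ * p + (- 1ℚ) * q) (off-target F-hit x x≢j) (off-target G-hit x x≢j) ⟩
      1ℚ * deg A x + (- 1ℚ) * deg A x
        ≡⟨ cancel (deg A x) ⟩
      0ℚ ∎)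

  hitting-unique : ∀ {F G} → IsHittingColumn A j F → IsHittingColumn A j G → ∀ i → F i ≡ G i
  hitting-unique F-hit G-hit i = ≤-antisym (hitting-≤ F-hit G-hit i) (hitting-≤ G-hit F-hit i)

  hitting-nonNeg : ∀ {F} → IsHittingColumn A j F → ∀ i → 0ℚ ≤ F i
  hitting-nonNeg {F} F-hit i = p-q≤0⇒p≤q (begin
    0ℚ - F i   ≤⟨ maximum-principle A (λ k → 0ℚ - F k) walks Δ≤0 i ⟩
    0ℚ - F j   ≡⟨ cong (λ x → 0ℚ - x) (at-target F-hit) ⟩
    0ℚ         ∎)
    where
    open ≤-Reasoning
    as-lincomb : ∀ x → 0ℚ - x ≡ (- 1ℚ) * x + 0ℚ * x + 0ℚ
    as-lincomb = solve-∀ ℚ-ring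
    negate : ∀ d → (- 1ℚ) * d + 0ℚ * d ≡ - d
    negate = solve-∀ ℚ-ring
    Δ≤0 : ∀ x → x ≢ j → Δ ⟦ A ⟧ (λ k → 0ℚ - F k) x ≤ 0ℚ
    Δ≤0 x x≢j = begin
      Δ ⟦ A ⟧ (λ k → 0ℚ - F k) x
        ≡⟨ Δ-lincomb ⟦ A ⟧ (λ k → 0ℚ - F k) F F (- 1ℚ) 0ℚ 0ℚ (λ k → as-lincomb (F k)) x ⟩
      (- 1ℚ) * Δ ⟦ A ⟧ F x + 0ℚ * Δ ⟦ A ⟧ F x
        ≡⟨ cong (λ p → (- 1ℚ) * p + 0ℚ * p) (off-target F-hit x x≢j) ⟩
      (- 1ℚ) * deg A x + 0ℚ * deg A x
        ≡⟨ negate (deg A x) ⟩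
      - deg A x
        ≤⟨ neg-antimono-≤ (deg-nonNeg A x) ⟩
      0ℚ ∎

kac : ∀ {N} {A : Adj N} → IsSymmetric A → ∀ {j F} → IsHittingColumn A j F → Δ ⟦ A ⟧ F j ≡ deg A j - vol A
kac {zero} _ {j = ()}
kac {suc N} {A} A-sym {j} {F} F-hit = begin
  Δ ⟦ A ⟧ F j
    ≡⟨ regroup (Δ ⟦ A ⟧ F j) rest (deg A j) ⟩
  (Δ ⟦ A ⟧ F j + rest) + (deg A j - (deg A j + rest))
    ≡⟨ cong₂ (λ s t → s + (deg A j - t)) total (sum-remove {i = j} (deg A)) ⟨
  0ℚ + (deg A j - vol A)
    ≡⟨ +-identityˡ (deg A j - vol A) ⟩
  deg A j - vol A ∎
  where
  open ≡-Reasoning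
  rest : ℚ
  rest = sum (λ k → deg A (punchIn j k))
  regroup : ∀ a r d → a ≡ (a + r) + (d - (d + r))
  regroup = solve-∀ ℚ-ring
  total : 0ℚ ≡ Δ ⟦ A ⟧ F j + rest
  total = begin
    0ℚ
      ≡⟨ ∑-Δ≡0 A A-sym F ⟨
    sum (Δ ⟦ A ⟧ F)
      ≡⟨ sum-remove {i = j} (Δ ⟦ A ⟧ F) ⟩
    Δ ⟦ A ⟧ F j + sum (λ k → Δ ⟦ A ⟧ F (punchIn j k))
      ≡⟨ cong (Δ ⟦ A ⟧ F j +_) (sum-cong-≗ (λ k → off-target F-hit (punchIn j k) (punchInᵢ≢i j k))) ⟩
    Δ ⟦ A ⟧ F j + rest ∎

Δ-hitting : ∀ {N} {A : Adj N} → IsSymmetric A → ∀ {j F} → IsHittingColumn A j F →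
            ∀ x → Δ ⟦ A ⟧ F x ≡ deg A x - δ x j * vol A
Δ-hitting {A = A} A-sym {j} F-hit x with x ≟ j
... | yes refl = trans (kac A-sym F-hit) (full-correction (deg A x) (vol A))
  where
  full-correction : ∀ d W → d - W ≡ d - 1ℚ * W
  full-correction = solve-∀ ℚ-ring
... | no x≢j = trans (off-target F-hit x x≢j) (no-correction (deg A x) (vol A))
  where
  no-correction : ∀ d W → d ≡ d - 0ℚ * W
  no-correction = solve-∀ ℚ-ring

targetSum : ∀ {N} → Adj N → (Fin N → Fin N → ℚ) → Fin N → ℚ
targetSum A m i = sum (λ j → deg A j * m i j)

targetSum-harmonic : ∀ {N} {A : Adj N} {m} → IsSymmetric A → IsHittingMatrix A m →
                     ∀ i → Δ ⟦ A ⟧ (targetSum A m) i ≡ 0ℚ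
targetSum-harmonic {A = A} {m} A-sym m-hit i = begin
  Δ ⟦ A ⟧ (targetSum A m) i
    ≡⟨ Δ-∑ ⟦ A ⟧ (deg A) (λ j k → m k j) i ⟩
  sum (λ j → deg A j * Δ ⟦ A ⟧ (λ k → m k j) i)
    ≡⟨ sum-cong-≗ (λ j → trans (cong (deg A j *_) (Δ-hitting A-sym (m-hit j) i))
                               (expand (deg A i) (deg A j) (δ i j) (vol A))) ⟩
  sum (λ j → deg A i * deg A j - δ i j * (deg A j * vol A))
    ≡⟨ ∑-distrib-- (λ j → deg A i * deg A j) (λ j → δ i j * (deg A j * vol A)) ⟩
  sum (λ j → deg A i * deg A j) - sum (λ j → δ i j * (deg A j * vol A))
    ≡⟨ cong₂ _-_ (*-distribˡ-sum (deg A i) (deg A)) (sym point-mass) ⟨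
  deg A i * vol A - deg A i * vol A
    ≡⟨ +-inverseʳ (deg A i * vol A) ⟩
  0ℚ ∎
  where
  open ≡-Reasoning
  expand : ∀ di dj e W → dj * (di - e * W) ≡ di * dj - e * (dj * W)
  expand = solve-∀ ℚ-ring
  point-mass : sum (λ j → δ i j * (deg A j * vol A)) ≡ deg A i * vol A
  point-mass = trans (sum-cong-≗ (λ j → cong (_* (deg A j * vol A)) (δ-sym i j))) (∑-δ i (λ j → deg A j * vol A))

targetSum-constant : ∀ {N} {A : Adj N} {m} → Connected A → IsSymmetric A → IsHittingMatrix A m →
                     ∀ i i′ → targetSum A m i ≡ targetSum A m i′
targetSum-constant {A = A} {m} conn A-sym m-hit i i′ = ≤-antisym (≤-everywhere i i′) (≤-everywhere i′ i)
  where
  ≤-everywhere : ∀ x y → targetSum A m x ≤ targetSum A m y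
  ≤-everywhere x y = maximum-principle A (targetSum A m) (λ z → conn z y)
                       (λ z _ → ≤-reflexive (targetSum-harmonic A-sym m-hit z)) x

-- Kemeny's constant

toℚ-if : ∀ b → toℚ (if b then 1 else 0) ≡ 𝟙 b
toℚ-if true = refl
toℚ-if false = refl

degree≡deg : ∀ {N} (A : Adj N) i → toℚ (degree A i) ≡ deg A i
degree≡deg A i = trans (toℚ-Σℕ (λ k → if A i k then 1 else 0)) (sum-cong-≗ (λ k → toℚ-if (A i k)))

vol≡totalDegree : ∀ {N} (A : Adj N) → vol A ≡ toℚ (totalDegree A)
vol≡totalDegree A = sym (trans (toℚ-Σℕ (degree A)) (sum-cong-≗ (degree≡deg A)))

Σℚ-neighbours : ∀ {N} (A : Adj N) (F : Fin N → ℚ) i →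
                Σℚ (λ k → if A i k then F k else 0ℚ) ≡ sum (λ k → ⟦ A ⟧ i k * F k)
Σℚ-neighbours A F i = trans (Σℚ≡sum (λ k → if A i k then F k else 0ℚ)) (sum-cong-≗ (λ k → if≡𝟙* (A i k) (F k)))
  where
  if≡𝟙* : ∀ b x → (if b then x else 0ℚ) ≡ 𝟙 b * x
  if≡𝟙* true x = sym (*-identityˡ x)
  if≡𝟙* false x = sym (*-zeroˡ x)

hitting-equation⇔ : ∀ {N} (A : Adj N) (F : Fin N → ℚ) i →
  (toℚ (degree A i) * F i ≡ toℚ (degree A i) + Σℚ (λ k → if A i k then F k else 0ℚ)) ⇔ (Δ ⟦ A ⟧ F i ≡ deg A i)
hitting-equation⇔ A F i = mk⇔ to from
  where
  open ≡-Reasoning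
  S : ℚ
  S = sum (λ k → ⟦ A ⟧ i k * F k)
  cancel : ∀ x y → x + y - y ≡ x
  cancel = solve-∀ ℚ-ring
  split : ∀ x y → x ≡ x - y + y
  split = solve-∀ ℚ-ring
  to : _ → Δ ⟦ A ⟧ F i ≡ deg A i
  to eq = begin
    Δ ⟦ A ⟧ F i
      ≡⟨ Δ-expand ⟦ A ⟧ F i ⟩
    deg A i * F i - S
      ≡⟨ cong (_- S) (subst₂ (λ d s → d * F i ≡ d + s) (degree≡deg A i) (Σℚ-neighbours A F i) eq) ⟩
    deg A i + S - S
      ≡⟨ cancel (deg A i) S ⟩
    deg A i ∎
  from : Δ ⟦ A ⟧ F i ≡ deg A i → _
  from eq = subst₂ (λ d s → d * F i ≡ d + s) (sym (degree≡deg A i)) (sym (Σℚ-neighbours A F i)) (begin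
    deg A i * F i           ≡⟨ split (deg A i * F i) S ⟩
    deg A i * F i - S + S   ≡⟨ cong (_+ S) (trans (sym (Δ-expand ⟦ A ⟧ F i)) eq) ⟩
    deg A i + S             ∎)

isHittingTimes⇔ : ∀ {N} (A : Adj N) m → IsHittingTimes A m ⇔ IsHittingMatrix A m
isHittingTimes⇔ A m = mk⇔
  (λ h j → record
    { at-target  = proj₁ (h j j) refl
    ; off-target = λ x x≢j → Equivalence.to (hitting-equation⇔ A (λ k → m k j) x) (proj₂ (h x j) x≢j) })
  (λ H i j → (λ { refl → at-target (H j) })
           , (λ i≢j → Equivalence.from (hitting-equation⇔ A (λ k → m k j) i) (off-target (H j) i i≢j)))

stationary-value : ∀ {N} (A : Adj N) {k} → totalDegree A ≡ suc k → ∀ j → stationary A j ≡ ℤ.+ degree A j / suc k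
stationary-value A e j with totalDegree A | e
... | .(suc _) | refl = refl

kemeny-vol : ∀ {N} (A : Adj N) {k} → totalDegree A ≡ suc k → ∀ m i → kemeny A m i * vol A ≡ targetSum A m i
kemeny-vol A {k} e m i = begin
  Σℚ (λ j → stationary A j * m i j) * vol A
    ≡⟨ cong₂ _*_ (Σℚ≡sum (λ j → stationary A j * m i j)) (trans (vol≡totalDegree A) (cong toℚ e)) ⟩
  sum (λ j → stationary A j * m i j) * toℚ (suc k)
    ≡⟨ *-distribʳ-sum (toℚ (suc k)) (λ j → stationary A j * m i j) ⟩
  sum (λ j → stationary A j * m i j * toℚ (suc k))
    ≡⟨ sum-cong-≗ weight ⟩
  targetSum A m i ∎
  where
  open ≡-Reasoning
  swap : ∀ s x t → s * x * t ≡ s * t * x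
  swap = solve-∀ ℚ-ring
  weight : ∀ j → stationary A j * m i j * toℚ (suc k) ≡ deg A j * m i j
  weight j = begin
    stationary A j * m i j * toℚ (suc k)
      ≡⟨ swap (stationary A j) (m i j) (toℚ (suc k)) ⟩
    stationary A j * toℚ (suc k) * m i j
      ≡⟨ cong (λ s → s * toℚ (suc k) * m i j) (stationary-value A e j) ⟩
    (ℤ.+ degree A j / suc k) * toℚ (suc k) * m i j
      ≡⟨ cong (_* m i j) (trans (/-*-cancel (degree A j) k) (degree≡deg A j)) ⟩
    deg A j * m i j ∎

totalDegree-suc : ∀ {N} (A : Adj N) → 0ℚ < vol A → ∃ λ k → totalDegree A ≡ suc k
totalDegree-suc A 0<vol with totalDegree A | vol≡totalDegree A
... | zero | vol≡0 = contradiction (subst (0ℚ <_) vol≡0 0<vol) (<-irrefl refl)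
... | suc k | _ = k , refl

kemeny-targetSum : ∀ {N} {A : Adj N} {m m₀} → Connected A → IsSymmetric A → 0ℚ < vol A →
                     IsHittingTimes A m → IsHittingMatrix A m₀ → ∀ i x → kemeny A m i * vol A ≡ targetSum A m₀ x
kemeny-targetSum {A = A} {m} {m₀} conn A-sym 0<vol m-hit m₀-hit i x = begin
  kemeny A m i * vol A
    ≡⟨ kemeny-vol A (proj₂ (totalDegree-suc A 0<vol)) m i ⟩
  targetSum A m i
    ≡⟨ targetSum-constant conn A-sym m-hit′ i x ⟩
  targetSum A m x
    ≡⟨ sum-cong-≗ (λ j → cong (deg A j *_) (hitting-unique (λ z → conn z j) (m-hit′ j) (m₀-hit j) x)) ⟩
  targetSum A m₀ x ∎
  where
  open ≡-Reasoning
  m-hit′ : IsHittingMatrix A m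
  m-hit′ = Equivalence.to (isHittingTimes⇔ A m) m-hit

-- Existence of hitting times

data Grounded {N} (w : Weights N) (c : Fin N → ℚ) : Fin N → Set where
  ground : ∀ {i} → 0ℚ < c i → Grounded w c i
  edge   : ∀ {i k} → 0ℚ < w i k → i ≢ k → Grounded w c k → Grounded w c i

Solves : ∀ {N} → Weights N → (c b f : Fin N → ℚ) → Set
Solves w c b f = ∀ i → Δ w f i + c i * f i ≡ b i

module KronReduction {N} (w : Weights (suc N)) (c b : Fin (suc N) → ℚ)
  (w≥0 : ∀ i k → 0ℚ ≤ w i k) (c≥0 : ∀ i → 0ℚ ≤ c i)
  (r : ℚ) (0<r : 0ℚ < r) (r-inverse : (sum (λ k → w zero (suc k)) + c zero) * r ≡ 1ℚ) where

  open ≡-Reasoning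

  -- The equation at vertex 0 gives f 0 = (b 0 + P f) * r (this is extend); substituting it
  -- into the other equations gives a system of the same kind on the remaining vertices.
  S : ℚ
  S = sum (λ k → w zero (suc k))

  P : (Fin N → ℚ) → ℚ
  P f = sum (λ k → w zero (suc k) * f k)

  extend : (Fin N → ℚ) → Fin (suc N) → ℚ
  extend f zero = (b zero + P f) * r
  extend f (suc i) = f i

  w′ : Weights N
  w′ i k = w (suc i) (suc k) + w (suc i) zero * (w zero (suc k) * r)

  c′ b′ : Fin N → ℚ
  c′ i = c (suc i) + w (suc i) zero * (c zero * r)
  b′ i = b (suc i) + w (suc i) zero * (b zero * r)

  w′≥0 : ∀ i k → 0ℚ ≤ w′ i k
  w′≥0 i k = +-mono-≤ (w≥0 _ _) (*-nonNeg (w≥0 _ _) (*-nonNeg (w≥0 _ _) (<⇒≤ 0<r)))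

  c′≥0 : ∀ i → 0ℚ ≤ c′ i
  c′≥0 i = +-mono-≤ (c≥0 _) (*-nonNeg (w≥0 _ _) (*-nonNeg (c≥0 _) (<⇒≤ 0<r)))

  mutual
    reduced-grounded : ∀ {i} → Grounded w c (suc i) → Grounded w′ c′ i
    reduced-grounded (ground 0<c) =
      ground (+-mono-<-≤ 0<c (*-nonNeg (w≥0 _ _) (*-nonNeg (c≥0 _) (<⇒≤ 0<r))))
    reduced-grounded (edge {k = zero} 0<w _ g) = via-zero 0<w g
    reduced-grounded (edge {k = suc k} 0<w i≢k g) =
      edge (+-mono-<-≤ 0<w (*-nonNeg (w≥0 _ _) (*-nonNeg (w≥0 _ _) (<⇒≤ 0<r)))) (i≢k ∘ cong suc) (reduced-grounded g)

    via-zero : ∀ {i} → 0ℚ < w (suc i) zero → Grounded w c zero → Grounded w′ c′ i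
    via-zero 0<w (ground 0<c) = ground (+-mono-≤-< (c≥0 _) (*-pos 0<w (*-pos 0<c 0<r)))
    via-zero 0<w (edge {k = zero} _ 0≢0 _) = contradiction refl 0≢0
    via-zero {i} 0<w (edge {k = suc k} 0<w′ _ g) with i ≟ k
    ... | yes refl = reduced-grounded g
    ... | no i≢k = edge (+-mono-≤-< (w≥0 _ _) (*-pos 0<w (*-pos 0<w′ 0<r))) i≢k (reduced-grounded g)

  solves-at-zero : ∀ f → Δ w (extend f) zero + c zero * extend f zero ≡ b zero
  solves-at-zero f = begin
    w zero zero * (F₀ - F₀) + sum (λ k → w zero (suc k) * (F₀ - f k)) + c zero * F₀
      ≡⟨ cong (λ s → w zero zero * (F₀ - F₀) + s + c zero * F₀) (∑-weighted-differences (λ k → w zero (suc k)) f F₀) ⟩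
    w zero zero * (F₀ - F₀) + (S * F₀ - P f) + c zero * F₀
      ≡⟨ rearrange (w zero zero) (b zero) (P f) r S (c zero) ⟩
    (b zero + P f) * ((S + c zero) * r) - P f
      ≡⟨ cong (λ u → (b zero + P f) * u - P f) r-inverse ⟩
    (b zero + P f) * 1ℚ - P f
      ≡⟨ cancel (b zero) (P f) ⟩
    b zero ∎
    where
    F₀ : ℚ
    F₀ = extend f zero
    rearrange : ∀ w₀₀ b₀ P r S c₀ →
                w₀₀ * ((b₀ + P) * r - (b₀ + P) * r) + (S * ((b₀ + P) * r) - P) + c₀ * ((b₀ + P) * r)
                ≡ (b₀ + P) * ((S + c₀) * r) - P
    rearrange = solve-∀ ℚ-ring
    cancel : ∀ b₀ P → (b₀ + P) * 1ℚ - P ≡ b₀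
    cancel = solve-∀ ℚ-ring

  Δw′ : ∀ f i → Δ w′ f i ≡ sum (λ k → w (suc i) (suc k) * (f i - f k)) + w (suc i) zero * r * (f i * S - P f)
  Δw′ f i = begin
    sum (λ k → w′ i k * (f i - f k))
      ≡⟨ sum-cong-≗ (λ k → split (w (suc i) (suc k)) wᵢ₀ (w zero (suc k)) r (f i - f k)) ⟩
    sum (λ k → w (suc i) (suc k) * (f i - f k) + wᵢ₀ * r * (w zero (suc k) * (f i - f k)))
      ≡⟨ ∑-distrib-+ (λ k → w (suc i) (suc k) * (f i - f k)) (λ k → wᵢ₀ * r * (w zero (suc k) * (f i - f k))) ⟩
    R + sum (λ k → wᵢ₀ * r * (w zero (suc k) * (f i - f k)))
      ≡⟨ cong (R +_) (*-distribˡ-sum (wᵢ₀ * r) (λ k → w zero (suc k) * (f i - f k))) ⟨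
    R + wᵢ₀ * r * sum (λ k → w zero (suc k) * (f i - f k))
      ≡⟨ cong (λ s → R + wᵢ₀ * r * s) (∑-weighted-differences (λ k → w zero (suc k)) f (f i)) ⟩
    R + wᵢ₀ * r * (S * f i - P f)
      ≡⟨ cong (λ s → R + wᵢ₀ * r * (s - P f)) (*-comm S (f i)) ⟩
    R + wᵢ₀ * r * (f i * S - P f) ∎
    where
    wᵢ₀ R : ℚ
    wᵢ₀ = w (suc i) zero
    R = sum (λ k → w (suc i) (suc k) * (f i - f k))
    split : ∀ a e g r d → (a + e * (g * r)) * d ≡ a * d + e * r * (g * d)
    split = solve-∀ ℚ-ring

  solves-at-suc : ∀ {f} → Solves w′ c′ b′ f → ∀ i → Δ w (extend f) (suc i) + c (suc i) * f i ≡ b (suc i)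
  solves-at-suc {f} f-solves i = begin
    wᵢ₀ * (f i - F₀) + R + c (suc i) * f i
      ≡⟨ cong (λ u → wᵢ₀ * (u - F₀) + R + c (suc i) * f i) (trans (cong (f i *_) r-inverse) (*-identityʳ (f i))) ⟨
    wᵢ₀ * (f i * ((S + c zero) * r) - F₀) + R + c (suc i) * f i
      ≡⟨ substitute wᵢ₀ (f i) (b zero) (P f) r R (c (suc i)) S (c zero) ⟩
    (R + wᵢ₀ * r * (f i * S - P f) + c′ i * f i) - wᵢ₀ * (b zero * r)
      ≡⟨ cong (λ s → s + c′ i * f i - wᵢ₀ * (b zero * r)) (Δw′ f i) ⟨
    (Δ w′ f i + c′ i * f i) - wᵢ₀ * (b zero * r)            ≡⟨ cong (_- wᵢ₀ * (b zero * r)) (f-solves i) ⟩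
    b′ i - wᵢ₀ * (b zero * r)                               ≡⟨ cancel (b (suc i)) (wᵢ₀ * (b zero * r)) ⟩
    b (suc i)                                               ∎
    where
    wᵢ₀ R F₀ : ℚ
    wᵢ₀ = w (suc i) zero
    R = sum (λ k → w (suc i) (suc k) * (f i - f k))
    F₀ = extend f zero
    substitute : ∀ w x b₀ P r R c S c₀ → w * (x * ((S + c₀) * r) - (b₀ + P) * r) + R + c * x
                                        ≡ (R + w * r * (x * S - P) + (c + w * (c₀ * r)) * x) - w * (b₀ * r)
    substitute = solve-∀ ℚ-ring
    cancel : ∀ x y → x + y - y ≡ x
    cancel = solve-∀ ℚ-ring

  extend-solves : ∀ {f} → Solves w′ c′ b′ f → Solves w c b (extend f)
  extend-solves {f} _ zero = solves-at-zero f
  extend-solves f-solves (suc i) = solves-at-suc f-solves i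

grounded-solvable : ∀ {N} (w : Weights N) (c b : Fin N → ℚ) → (∀ i k → 0ℚ ≤ w i k) → (∀ i → 0ℚ ≤ c i) →
                    (∀ i → Grounded w c i) → ∃ (Solves w c b)
grounded-solvable {zero} w c b _ _ _ = (λ ()) , (λ ())
grounded-solvable {suc N} w c b w≥0 c≥0 grounded = extend f , extend-solves f-solves
  where
  D : ℚ
  D = sum (λ k → w zero (suc k)) + c zero
  0<D : Grounded w c zero → 0ℚ < D
  0<D (ground 0<c) = +-mono-≤-< (sum-nonNeg _ (λ k → w≥0 zero (suc k))) 0<c
  0<D (edge {k = zero} _ 0≢0 _) = contradiction refl 0≢0
  0<D (edge {k = suc k} 0<w _ _) =
    +-mono-<-≤ (<-≤-trans 0<w (≤-sum (λ k → w zero (suc k)) (λ k → w≥0 zero (suc k)) k)) (c≥0 zero)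
  instance
    D-positive : Positive D
    D-positive = positive (0<D (grounded zero))
    D≢0 : NonZero D
    D≢0 = pos⇒nonZero D
  open KronReduction w c b w≥0 c≥0 (1/ D) (positive⁻¹ (1/ D) {{1/pos⇒pos D}}) (*-inverseʳ D)
  solution : ∃ (Solves w′ c′ b′)
  solution = grounded-solvable w′ c′ b′ w′≥0 c′≥0 (λ i → reduced-grounded (grounded (suc i)))
  f : Fin N → ℚ
  f = proj₁ solution
  f-solves : Solves w′ c′ b′ f
  f-solves = proj₂ solution

module RestrictedSystem {N} (A : Adj (suc N)) (j : Fin (suc N)) where

  open ≡-Reasoning

  w : Weights N
  w i k = ⟦ A ⟧ (punchIn j i) (punchIn j k)

  c b : Fin N → ℚ
  c i = ⟦ A ⟧ (punchIn j i) j
  b i = deg A (punchIn j i)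

  0<𝟙 : ∀ {x y} → A x y ≡ true → 0ℚ < ⟦ A ⟧ x y
  0<𝟙 Axy = subst (λ e → 0ℚ < 𝟙 e) (sym Axy) (positive⁻¹ 1ℚ)

  walk⇒grounded : ∀ {y} → Walk A y j → ∀ y′ → punchIn j y′ ≡ y → Grounded w c y′
  walk⇒grounded here y′ e = contradiction e (punchInᵢ≢i j y′)
  walk⇒grounded (step {j = z} Ayz rest) y′ refl with z ≟ j
  ... | yes refl = ground (0<𝟙 Ayz)
  ... | no z≢j with y′ ≟ punchOut (z≢j ∘ sym)
  ...   | yes refl = walk⇒grounded rest y′ (punchIn-punchOut (z≢j ∘ sym))
  ...   | no y′≢z′ = edge (0<𝟙 (subst (λ z′ → A (punchIn j y′) z′ ≡ true) (sym (punchIn-punchOut (z≢j ∘ sym))) Ayz))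
                          y′≢z′ (walk⇒grounded rest _ (punchIn-punchOut (z≢j ∘ sym)))

  extend-by-zero : (Fin N → ℚ) → Fin (suc N) → ℚ
  extend-by-zero f x with j ≟ x
  ... | yes _ = 0ℚ
  ... | no j≢x = f (punchOut j≢x)

  extend-at-j : ∀ f → extend-by-zero f j ≡ 0ℚ
  extend-at-j f with j ≟ j
  ... | yes _ = refl
  ... | no j≢j = contradiction refl j≢j

  extend-punchIn : ∀ f i → extend-by-zero f (punchIn j i) ≡ f i
  extend-punchIn f i with j ≟ punchIn j i
  ... | yes j≡ = contradiction (sym j≡) (punchInᵢ≢i j i)
  ... | no _ = cong f (trans (punchOut-cong j refl) (punchOut-punchIn j))

  Δ-extend : ∀ f i → Δ ⟦ A ⟧ (extend-by-zero f) (punchIn j i) ≡ Δ w f i + c i * f i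
  Δ-extend f i = begin
    Δ ⟦ A ⟧ F (punchIn j i)
      ≡⟨ sum-remove {i = j} (λ k → ⟦ A ⟧ (punchIn j i) k * (F (punchIn j i) - F k)) ⟩
    c i * (F (punchIn j i) - F j) + sum (λ k → w i k * (F (punchIn j i) - F (punchIn j k)))
      ≡⟨ cong₂ (λ x y → c i * (x - y) + sum (λ k → w i k * (x - F (punchIn j k)))) (extend-punchIn f i) (extend-at-j f) ⟩
    c i * (f i - 0ℚ) + sum (λ k → w i k * (f i - F (punchIn j k)))
      ≡⟨ cong (λ s → c i * (f i - 0ℚ) + s) (sum-cong-≗ (λ k → cong (λ y → w i k * (f i - y)) (extend-punchIn f k))) ⟩
    c i * (f i - 0ℚ) + Δ w f i
      ≡⟨ swap (c i) (f i) (Δ w f i) ⟩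
    Δ w f i + c i * f i ∎
    where
    F : Fin (suc N) → ℚ
    F = extend-by-zero f
    swap : ∀ c x d → c * (x - 0ℚ) + d ≡ d + c * x
    swap = solve-∀ ℚ-ring

  extend-hitting : ∀ {f} → Solves w c b f → IsHittingColumn A j (extend-by-zero f)
  extend-hitting {f} f-solves = record
    { at-target  = extend-at-j f
    ; off-target = λ x x≢j → subst (λ y → Δ ⟦ A ⟧ (extend-by-zero f) y ≡ deg A y)
                                   (punchIn-punchOut (x≢j ∘ sym)) (trans (Δ-extend f _) (f-solves _)) }

hitting-column : ∀ {N} (A : Adj (suc N)) j → (∀ i → Walk A i j) → ∃ (IsHittingColumn A j)
hitting-column A j walks = extend-by-zero (proj₁ solution) , extend-hitting (proj₂ solution)
  where
  open RestrictedSystem A j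
  solution : ∃ (Solves w c b)
  solution = grounded-solvable w c b (λ i k → 𝟙-nonNeg (A (punchIn j i) (punchIn j k)))
                                     (λ i → 𝟙-nonNeg (A (punchIn j i) j))
                                     (λ i → walk⇒grounded (walks (punchIn j i)) i refl)

hitting-matrix : ∀ {N} (A : Adj N) → Connected A → ∃ (IsHittingMatrix A)
hitting-matrix {zero} A conn = (λ ()) , (λ ())
hitting-matrix {suc N} A conn = (λ i j → proj₁ (column j) i) , (λ j → proj₂ (column j))
  where
  column : ∀ j → ∃ (IsHittingColumn A j)
  column j = hitting-column A j (λ i → conn i j)

hitting-times-exist : ∀ {N} {A : Adj N} → Connected A → ∃ (IsHittingTimes A)
hitting-times-exist {A = A} conn =
  proj₁ (hitting-matrix A conn) , Equivalence.from (isHittingTimes⇔ A _) (proj₂ (hitting-matrix A conn))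

-- Attaching three new vertices

_++ʷ_ : ∀ {N} {A : Adj N} {x y z} → Walk A x y → Walk A y z → Walk A x z
here ++ʷ w′ = w′
step e w ++ʷ w′ = step e (w ++ʷ w′)

module Attach {n} (A : Adj n) (v : Fin n) (E : Adj 3) where

  H : Adj (3 ℕ.+ n)
  H = attach A v E

  new : Fin 3 → Fin (3 ℕ.+ n)
  new p = p ↑ˡ n

  old : Fin n → Fin (3 ℕ.+ n)
  old i = 3 ↑ʳ i

  data NewOrOld : Fin (3 ℕ.+ n) → Set where
    is-new : ∀ p → NewOrOld (new p)
    is-old : ∀ i → NewOrOld (old i)

  newOrOld : ∀ x → NewOrOld x
  newOrOld zero = is-new zero
  newOrOld (suc zero) = is-new (suc zero)
  newOrOld (suc (suc zero)) = is-new (suc (suc zero))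
  newOrOld (suc (suc (suc i))) = is-old i

  H-new-new : ∀ p q → H (new p) (new q) ≡ E p q
  H-new-new p q rewrite splitAt-↑ˡ 3 p n | splitAt-↑ˡ 3 q n = refl

  H-new-old : ∀ p i → H (new p) (old i) ≡ ⌊ i ≟ v ⌋
  H-new-old p i rewrite splitAt-↑ˡ 3 p n = refl

  H-old-new : ∀ i q → H (old i) (new q) ≡ ⌊ i ≟ v ⌋
  H-old-new i q rewrite splitAt-↑ˡ 3 q n = refl

  ∑-split : ∀ (g : Fin (3 ℕ.+ n) → ℚ) → sum g ≡ sum (g ∘ new) + sum (g ∘ old)
  ∑-split g = regroup (g zero) (g (suc zero)) (g (suc (suc zero))) (sum (g ∘ old))
    where
    regroup : ∀ a b c s → a + (b + (c + s)) ≡ a + (b + (c + 0ℚ)) + s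
    regroup = solve-∀ ℚ-ring

  deg-new : ∀ p → deg H (new p) ≡ deg E p + 1ℚ
  deg-new p = trans (∑-split (⟦ H ⟧ (new p)))
    (cong₂ _+_ (sum-cong-≗ (λ q → cong 𝟙 (H-new-new p q)))
               (trans (sum-cong-≗ (λ i → trans (cong 𝟙 (H-new-old p i)) (sym (*-identityʳ (δ i v)))))
                      (∑-δ v (λ _ → 1ℚ))))

  deg-old : ∀ i → deg H (old i) ≡ ℤ.+ 3 / 1 * δ i v + deg A i
  deg-old i = trans (∑-split (⟦ H ⟧ (old i)))
    (cong (_+ deg A i) (trans (sum-cong-≗ (λ q → cong 𝟙 (H-old-new i q))) (thrice (δ i v))))
    where
    thrice : ∀ e → e + (e + (e + 0ℚ)) ≡ ℤ.+ 3 / 1 * e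
    thrice = solve-∀ ℚ-ring

  Δ-new : ∀ F p → Δ ⟦ H ⟧ F (new p) ≡ Δ ⟦ E ⟧ (F ∘ new) p + (F (new p) - F (old v))
  Δ-new F p = trans (∑-split (λ k → ⟦ H ⟧ (new p) k * (F (new p) - F k)))
    (cong₂ _+_ (sum-cong-≗ (λ q → cong (λ e → 𝟙 e * (F (new p) - F (new q))) (H-new-new p q)))
               (trans (sum-cong-≗ (λ i → cong (λ e → 𝟙 e * (F (new p) - F (old i))) (H-new-old p i)))
                      (∑-δ v (λ i → F (new p) - F (old i)))))

  Δ-old : ∀ F i → Δ ⟦ H ⟧ F (old i) ≡ δ i v * sum (λ q → F (old i) - F (new q)) + Δ ⟦ A ⟧ (F ∘ old) i
  Δ-old F i = trans (∑-split (λ k → ⟦ H ⟧ (old i) k * (F (old i) - F k)))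
    (cong (_+ Δ ⟦ A ⟧ (F ∘ old) i)
          (trans (sum-cong-≗ (λ q → cong (λ e → 𝟙 e * (F (old i) - F (new q))) (H-old-new i q)))
                 (sym (*-distribˡ-sum (δ i v) (λ q → F (old i) - F (new q))))))

  vol-attach : vol H ≡ sum (λ p → deg E p + 1ℚ) + (ℤ.+ 3 / 1 + vol A)
  vol-attach = begin
    vol H
      ≡⟨ ∑-split (deg H) ⟩
    sum (deg H ∘ new) + sum (deg H ∘ old)
      ≡⟨ cong₂ _+_ (sum-cong-≗ deg-new) (sum-cong-≗ (λ i → trans (deg-old i) (sym (*-identityʳ _)))) ⟩
    sum (λ p → deg E p + 1ℚ) + sum (λ i → (ℤ.+ 3 / 1 * δ i v + deg A i) * 1ℚ)
      ≡⟨ cong (sum (λ p → deg E p + 1ℚ) +_) (∑-point-mass v (ℤ.+ 3 / 1) (deg A) (λ _ → 1ℚ)) ⟩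
    sum (λ p → deg E p + 1ℚ) + (ℤ.+ 3 / 1 * 1ℚ + sum (λ i → deg A i * 1ℚ))
      ≡⟨ cong (λ s → sum (λ p → deg E p + 1ℚ) + (ℤ.+ 3 / 1 * 1ℚ + s)) (sum-cong-≗ (λ i → *-identityʳ (deg A i))) ⟩
    sum (λ p → deg E p + 1ℚ) + (ℤ.+ 3 / 1 + vol A) ∎
    where open ≡-Reasoning

  ⌊v≟v⌋ : ⌊ v ≟ v ⌋ ≡ true
  ⌊v≟v⌋ with v ≟ v
  ... | yes _ = refl
  ... | no v≢v = contradiction refl v≢v

  attach-symmetric : IsSymmetric E → IsSymmetric A → IsSymmetric H
  attach-symmetric E-sym A-sym x y with newOrOld x | newOrOld y
  ... | is-new p | is-new q = trans (H-new-new p q) (trans (E-sym p q) (sym (H-new-new q p)))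
  ... | is-new p | is-old j = trans (H-new-old p j) (sym (H-old-new j p))
  ... | is-old i | is-new q = trans (H-old-new i q) (sym (H-new-old q i))
  ... | is-old i | is-old j = A-sym i j

  attach-connected : Connected A → Connected H
  attach-connected conn x y = to-v x ++ʷ from-v y
    where
    lift : ∀ {i j} → Walk A i j → Walk H (old i) (old j)
    lift here = here
    lift (step e w) = step e (lift w)
    to-v : ∀ x → Walk H x (old v)
    to-v x with newOrOld x
    ... | is-new p = step (trans (H-new-old p v) ⌊v≟v⌋) here
    ... | is-old i = lift (conn i v)
    from-v : ∀ y → Walk H (old v) y
    from-v y with newOrOld y
    ... | is-new q = step (trans (H-old-new v q) ⌊v≟v⌋) here
    ... | is-old j = lift (conn v j)

-- τ p, σ W q and ρ W p q are the hitting times from a new vertex p to v, from v to a new vertex q,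
-- and between new vertices, when the base graph has volume W. They are affine in W and obey linear
-- equations, so the equations are imposed on the two coefficients separately, as closed identities.
record Gadget (E : Adj 3) : Set where
  field
    τ       : Fin 3 → ℚ
    σ₀ σ₁   : Fin 3 → ℚ
    ρ₀ ρ₁   : Fin 3 → Fin 3 → ℚ
    τ-eq    : ∀ p → Δ ⟦ E ⟧ τ p + τ p ≡ deg E p + 1ℚ
    σ₀-eq   : ∀ q → sum (λ r → σ₀ q - ρ₀ r q) ≡ ℤ.+ 3 / 1
    σ₁-eq   : ∀ q → sum (λ r → σ₁ q - ρ₁ r q) ≡ 1ℚ
    ρ₀-eq   : ∀ p q → p ≢ q → Δ ⟦ E ⟧ (λ r → ρ₀ r q) p + (ρ₀ p q - σ₀ q) ≡ deg E p + 1ℚ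
    ρ₁-eq   : ∀ p q → p ≢ q → Δ ⟦ E ⟧ (λ r → ρ₁ r q) p + (ρ₁ p q - σ₁ q) ≡ 0ℚ
    ρ₀-diag : ∀ p → ρ₀ p p ≡ 0ℚ
    ρ₁-diag : ∀ p → ρ₁ p p ≡ 0ℚ

  σ : ℚ → Fin 3 → ℚ
  σ W q = σ₀ q + σ₁ q * W

  ρ : ℚ → Fin 3 → Fin 3 → ℚ
  ρ W p q = ρ₀ p q + ρ₁ p q * W

  σ-eq : ∀ W q → sum (λ r → σ W q - ρ W r q) ≡ ℤ.+ 3 / 1 + W
  σ-eq W q = begin
    sum (λ r → σ W q - ρ W r q)
      ≡⟨ sum-cong-≗ (λ r → regroup (σ₀ q) (σ₁ q) (ρ₀ r q) (ρ₁ r q) W) ⟩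
    sum (λ r → (σ₀ q - ρ₀ r q) + (σ₁ q - ρ₁ r q) * W)
      ≡⟨ ∑-affine (λ r → σ₀ q - ρ₀ r q) (λ r → σ₁ q - ρ₁ r q) W ⟩
    sum (λ r → σ₀ q - ρ₀ r q) + sum (λ r → σ₁ q - ρ₁ r q) * W
      ≡⟨ cong₂ (λ x y → x + y * W) (σ₀-eq q) (σ₁-eq q) ⟩
    ℤ.+ 3 / 1 + 1ℚ * W
      ≡⟨ cong (ℤ.+ 3 / 1 +_) (*-identityˡ W) ⟩
    ℤ.+ 3 / 1 + W ∎
    where
    open ≡-Reasoning
    regroup : ∀ s₀ s₁ r₀ r₁ W → s₀ + s₁ * W - (r₀ + r₁ * W) ≡ (s₀ - r₀) + (s₁ - r₁) * W
    regroup = solve-∀ ℚ-ring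

  ρ-eq : ∀ W p q → p ≢ q → Δ ⟦ E ⟧ (λ r → ρ W r q) p + (ρ W p q - σ W q) ≡ deg E p + 1ℚ
  ρ-eq W p q p≢q = begin
    Δ ⟦ E ⟧ (λ r → ρ W r q) p + (ρ W p q - σ W q)
      ≡⟨ cong (_+ (ρ W p q - σ W q))
              (Δ-lincomb ⟦ E ⟧ (λ r → ρ W r q) (λ r → ρ₀ r q) (λ r → ρ₁ r q) 1ℚ W 0ℚ
                         (λ r → as-lincomb (ρ₀ r q) (ρ₁ r q) W) p) ⟩
    1ℚ * Δ₀ + W * Δ₁ + (ρ W p q - σ W q)
      ≡⟨ regroup Δ₀ Δ₁ (ρ₀ p q) (ρ₁ p q) (σ₀ q) (σ₁ q) W ⟩
    (Δ₀ + (ρ₀ p q - σ₀ q)) + (Δ₁ + (ρ₁ p q - σ₁ q)) * W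
      ≡⟨ cong₂ (λ x y → x + y * W) (ρ₀-eq p q p≢q) (ρ₁-eq p q p≢q) ⟩
    deg E p + 1ℚ + 0ℚ * W
      ≡⟨ drop (deg E p + 1ℚ) W ⟩
    deg E p + 1ℚ ∎
    where
    open ≡-Reasoning
    Δ₀ Δ₁ : ℚ
    Δ₀ = Δ ⟦ E ⟧ (λ r → ρ₀ r q) p
    Δ₁ = Δ ⟦ E ⟧ (λ r → ρ₁ r q) p
    as-lincomb : ∀ r₀ r₁ W → r₀ + r₁ * W ≡ 1ℚ * r₀ + W * r₁ + 0ℚ
    as-lincomb = solve-∀ ℚ-ring
    regroup : ∀ Δ₀ Δ₁ r₀ r₁ s₀ s₁ W → 1ℚ * Δ₀ + W * Δ₁ + (r₀ + r₁ * W - (s₀ + s₁ * W))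
                                      ≡ (Δ₀ + (r₀ - s₀)) + (Δ₁ + (r₁ - s₁)) * W
    regroup = solve-∀ ℚ-ring
    drop : ∀ x W → x + 0ℚ * W ≡ x
    drop = solve-∀ ℚ-ring

  ρ-diag : ∀ W p → ρ W p p ≡ 0ℚ
  ρ-diag W p = trans (cong₂ (λ x y → x + y * W) (ρ₀-diag p) (ρ₁-diag p))
                     (trans (+-identityˡ (0ℚ * W)) (*-zeroˡ W))

  ∑-weighted-σ : ∀ (c : Fin 3 → ℚ) W →
                 sum (λ q → c q * σ W q) ≡ sum (λ q → c q * σ₀ q) + sum (λ q → c q * σ₁ q) * W
  ∑-weighted-σ c W = trans (sum-cong-≗ (λ q → distrib (c q) (σ₀ q) (σ₁ q) W))
                           (∑-affine (λ q → c q * σ₀ q) (λ q → c q * σ₁ q) W)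
    where
    distrib : ∀ c s₀ s₁ W → c * (s₀ + s₁ * W) ≡ c * s₀ + c * s₁ * W
    distrib = solve-∀ ℚ-ring

module Glued {n} {A : Adj n} (A-sym : IsSymmetric A) (conn : Connected A) (v : Fin n)
  {E : Adj 3} (E-sym : IsSymmetric E) (g : Gadget E)
  {h : Fin n → Fin n → ℚ} (h-hit : IsHittingMatrix A h)
  (κ : ℚ) (κ-eq : κ * vol A ≡ sum (Gadget.τ g) + ℤ.+ 3 / 1) where

  open Attach A v E
  open Gadget g using (τ; τ-eq)
  open ≡-Reasoning

  σ : Fin 3 → ℚ
  σ = Gadget.σ g (vol A)

  ρ : Fin 3 → Fin 3 → ℚ
  ρ = Gadget.ρ g (vol A)

  h-diag : ∀ i → h i i ≡ 0ℚ
  h-diag i = at-target (h-hit i)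

  Δh : ∀ j x → Δ ⟦ A ⟧ (λ k → h k j) x ≡ deg A x - δ x j * vol A
  Δh j = Δ-hitting A-sym (h-hit j)

  -- From i, the walk visits v on average (h i j + h j v - h i v) · deg A v / vol A times before
  -- reaching j, and each visit adds an excursion through the new vertices of mean length
  -- (Σ τ + 3) / deg A v.
  hᴴ : Fin n → Fin n → ℚ
  hᴴ i j = (1ℚ + κ) * h i j + (- κ) * h i v + κ * h j v

  glued : Fin (3 ℕ.+ n) → Fin (3 ℕ.+ n) → ℚ
  glued x y with splitAt 3 x | splitAt 3 y
  ... | inj₁ p | inj₁ q = ρ p q
  ... | inj₁ p | inj₂ j = τ p + hᴴ v j
  ... | inj₂ i | inj₁ q = h i v + σ q
  ... | inj₂ i | inj₂ j = hᴴ i j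

  glued-new-new : ∀ p q → glued (new p) (new q) ≡ ρ p q
  glued-new-new p q rewrite splitAt-↑ˡ 3 p n | splitAt-↑ˡ 3 q n = refl

  glued-new-old : ∀ p j → glued (new p) (old j) ≡ τ p + hᴴ v j
  glued-new-old p j rewrite splitAt-↑ˡ 3 p n = refl

  glued-old-new : ∀ i q → glued (old i) (new q) ≡ h i v + σ q
  glued-old-new i q rewrite splitAt-↑ˡ 3 q n = refl

  hᴴ-diag : ∀ i → hᴴ i i ≡ 0ℚ
  hᴴ-diag i = trans (cong (λ x → (1ℚ + κ) * x + (- κ) * h i v + κ * h i v) (h-diag i)) (vanish κ (h i v))
    where
    vanish : ∀ κ x → (1ℚ + κ) * 0ℚ + (- κ) * x + κ * x ≡ 0ℚ
    vanish = solve-∀ ℚ-ring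

  Δhᴴ : ∀ {i j} → i ≢ j → Δ ⟦ A ⟧ (λ k → hᴴ k j) i ≡ deg A i + κ * (δ i v * vol A)
  Δhᴴ {i} {j} i≢j = begin
    Δ ⟦ A ⟧ (λ k → hᴴ k j) i
      ≡⟨ Δ-lincomb ⟦ A ⟧ (λ k → hᴴ k j) (λ k → h k j) (λ k → h k v) (1ℚ + κ) (- κ) (κ * h j v) (λ _ → refl) i ⟩
    (1ℚ + κ) * Δ ⟦ A ⟧ (λ k → h k j) i + (- κ) * Δ ⟦ A ⟧ (λ k → h k v) i
      ≡⟨ cong₂ (λ x y → (1ℚ + κ) * x + (- κ) * y)
               (trans (Δh j i) (cong (λ e → deg A i - e * vol A) (δ-≢ i≢j))) (Δh v i) ⟩
    (1ℚ + κ) * (deg A i - 0ℚ * vol A) + (- κ) * (deg A i - δ i v * vol A)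
      ≡⟨ simplify κ (deg A i) (δ i v) (vol A) ⟩
    deg A i + κ * (δ i v * vol A) ∎
    where
    simplify : ∀ κ d e W → (1ℚ + κ) * (d - 0ℚ * W) + (- κ) * (d - e * W) ≡ d + κ * (e * W)
    simplify = solve-∀ ℚ-ring

  toward-old-from-new : ∀ j p → Δ ⟦ H ⟧ (λ x → glued x (old j)) (new p) ≡ deg H (new p)
  toward-old-from-new j p = begin
    Δ ⟦ H ⟧ F (new p)
      ≡⟨ Δ-new F p ⟩
    Δ ⟦ E ⟧ (F ∘ new) p + (F (new p) - hᴴ v j)
      ≡⟨ cong₂ (λ s x → s + (x - hᴴ v j)) (Δ-cong ⟦ E ⟧ (λ r → glued-new-old r j) p) (glued-new-old p j) ⟩
    Δ ⟦ E ⟧ (λ r → τ r + hᴴ v j) p + (τ p + hᴴ v j - hᴴ v j)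
      ≡⟨ cong₂ _+_ (Δ-shift ⟦ E ⟧ τ (hᴴ v j) p) (cancel (τ p) (hᴴ v j)) ⟩
    Δ ⟦ E ⟧ τ p + τ p
      ≡⟨ τ-eq p ⟩
    deg E p + 1ℚ
      ≡⟨ deg-new p ⟨
    deg H (new p) ∎
    where
    F : Fin (3 ℕ.+ n) → ℚ
    F x = glued x (old j)
    cancel : ∀ x y → x + y - y ≡ x
    cancel = solve-∀ ℚ-ring

  toward-old-from-old : ∀ {i j} → i ≢ j → Δ ⟦ H ⟧ (λ x → glued x (old j)) (old i) ≡ deg H (old i)
  toward-old-from-old {i} {j} i≢j = begin
    Δ ⟦ H ⟧ F (old i)                                                           ≡⟨ Δ-old F i ⟩
    δ i v * sum (λ q → hᴴ i j - F (new q)) + Δ ⟦ A ⟧ (λ k → hᴴ k j) i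
      ≡⟨ cong₂ _+_ (cong (δ i v *_) (sum-cong-≗ (λ q → cong (λ x → hᴴ i j - x) (glued-new-old q j)))) (Δhᴴ i≢j) ⟩
    δ i v * sum (λ q → hᴴ i j - (τ q + hᴴ v j)) + (deg A i + κ * (δ i v * vol A)) ≡⟨ excursions i ⟩
    ℤ.+ 3 / 1 * δ i v + deg A i                                                   ≡⟨ deg-old i ⟨
    deg H (old i)                                                               ∎
    where
    F : Fin (3 ℕ.+ n) → ℚ
    F x = glued x (old j)
    reassoc : ∀ m t → m - (t + m) ≡ 0ℚ - t
    reassoc = solve-∀ ℚ-ring
    balance : ∀ T d → 1ℚ * (0ℚ - T) + (d + (T + ℤ.+ 3 / 1)) ≡ ℤ.+ 3 / 1 * 1ℚ + d
    balance = solve-∀ ℚ-ring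
    away : ∀ S d κ W → 0ℚ * S + (d + κ * (0ℚ * W)) ≡ ℤ.+ 3 / 1 * 0ℚ + d
    away = solve-∀ ℚ-ring
    into-excursions : sum (λ q → hᴴ v j - (τ q + hᴴ v j)) ≡ 0ℚ - sum τ
    into-excursions = trans (sum-cong-≗ (λ q → reassoc (hᴴ v j) (τ q)))
                            (trans (∑-distrib-- (λ _ → 0ℚ) τ) (cong (_- sum τ) (sum-replicate-zero 3)))
    excursions : ∀ i → δ i v * sum (λ q → hᴴ i j - (τ q + hᴴ v j)) + (deg A i + κ * (δ i v * vol A))
                       ≡ ℤ.+ 3 / 1 * δ i v + deg A i
    excursions i with i ≟ v
    ... | yes refl = begin
      1ℚ * sum (λ q → hᴴ v j - (τ q + hᴴ v j)) + (deg A v + κ * (1ℚ * vol A))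
        ≡⟨ cong₂ (λ s K → 1ℚ * s + (deg A v + K)) into-excursions (trans (cong (κ *_) (*-identityˡ (vol A))) κ-eq) ⟩
      1ℚ * (0ℚ - sum τ) + (deg A v + (sum τ + ℤ.+ 3 / 1))
        ≡⟨ balance (sum τ) (deg A v) ⟩
      ℤ.+ 3 / 1 * 1ℚ + deg A v ∎
    ... | no _ = away (sum (λ q → hᴴ i j - (τ q + hᴴ v j))) (deg A i) κ (vol A)

  toward-new-from-new : ∀ {p q} → p ≢ q → Δ ⟦ H ⟧ (λ x → glued x (new q)) (new p) ≡ deg H (new p)
  toward-new-from-new {p} {q} p≢q = begin
    Δ ⟦ H ⟧ F (new p)
      ≡⟨ Δ-new F p ⟩
    Δ ⟦ E ⟧ (F ∘ new) p + (F (new p) - F (old v))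
      ≡⟨ cong₂ _+_ (Δ-cong ⟦ E ⟧ (λ r → glued-new-new r q) p) (cong₂ _-_ (glued-new-new p q) (glued-old-new v q)) ⟩
    Δ ⟦ E ⟧ (λ r → ρ r q) p + (ρ p q - (h v v + σ q))
      ≡⟨ cong (λ x → Δ ⟦ E ⟧ (λ r → ρ r q) p + (ρ p q - x)) (trans (cong (_+ σ q) (h-diag v)) (+-identityˡ (σ q))) ⟩
    Δ ⟦ E ⟧ (λ r → ρ r q) p + (ρ p q - σ q)
      ≡⟨ Gadget.ρ-eq g (vol A) p q p≢q ⟩
    deg E p + 1ℚ
      ≡⟨ deg-new p ⟨
    deg H (new p) ∎
    where
    F : Fin (3 ℕ.+ n) → ℚ
    F x = glued x (new q)

  toward-new-from-old : ∀ q i → Δ ⟦ H ⟧ (λ x → glued x (new q)) (old i) ≡ deg H (old i)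
  toward-new-from-old q i = begin
    Δ ⟦ H ⟧ F (old i)
      ≡⟨ Δ-old F i ⟩
    δ i v * sum (λ r → F (old i) - F (new r)) + Δ ⟦ A ⟧ (F ∘ old) i
      ≡⟨ cong₂ _+_ (cong (δ i v *_) (sum-cong-≗ (λ r → cong₂ _-_ (glued-old-new i q) (glued-new-new r q))))
                   (trans (Δ-cong ⟦ A ⟧ (λ k → glued-old-new k q) i)
                          (trans (Δ-shift ⟦ A ⟧ (λ k → h k v) (σ q) i) (Δh v i))) ⟩
    δ i v * sum (λ r → h i v + σ q - ρ r q) + (deg A i - δ i v * vol A)
      ≡⟨ excursions i ⟩
    ℤ.+ 3 / 1 * δ i v + deg A i
      ≡⟨ deg-old i ⟨
    deg H (old i) ∎
    where
    F : Fin (3 ℕ.+ n) → ℚ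
    F x = glued x (new q)
    balance : ∀ d W → 1ℚ * (ℤ.+ 3 / 1 + W) + (d - 1ℚ * W) ≡ ℤ.+ 3 / 1 * 1ℚ + d
    balance = solve-∀ ℚ-ring
    away : ∀ S d W → 0ℚ * S + (d - 0ℚ * W) ≡ ℤ.+ 3 / 1 * 0ℚ + d
    away = solve-∀ ℚ-ring
    excursions : ∀ i → δ i v * sum (λ r → h i v + σ q - ρ r q) + (deg A i - δ i v * vol A) ≡ ℤ.+ 3 / 1 * δ i v + deg A i
    excursions i with i ≟ v
    ... | yes refl = begin
      1ℚ * sum (λ r → h v v + σ q - ρ r q) + (deg A v - 1ℚ * vol A)
        ≡⟨ cong (λ s → 1ℚ * s + (deg A v - 1ℚ * vol A))
                (trans (sum-cong-≗ (λ r → cong (λ x → x + σ q - ρ r q) (h-diag v)))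
                       (trans (sum-cong-≗ (λ r → cong (_- ρ r q) (+-identityˡ (σ q)))) (Gadget.σ-eq g (vol A) q))) ⟩
      1ℚ * (ℤ.+ 3 / 1 + vol A) + (deg A v - 1ℚ * vol A)
        ≡⟨ balance (deg A v) (vol A) ⟩
      ℤ.+ 3 / 1 * 1ℚ + deg A v ∎
    ... | no _ = away (sum (λ r → h i v + σ q - ρ r q)) (deg A i) (vol A)

  glued-hitting : IsHittingMatrix H glued
  glued-hitting y with newOrOld y
  ... | is-new q = record
    { at-target  = trans (glued-new-new q q) (Gadget.ρ-diag g (vol A) q)
    ; off-target = λ x x≢new-q → toward-new x x≢new-q (newOrOld x) }
    where
    toward-new : ∀ x → x ≢ new q → NewOrOld x → Δ ⟦ H ⟧ (λ z → glued z (new q)) x ≡ deg H x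
    toward-new _ x≢ (is-new p) = toward-new-from-new (x≢ ∘ cong new)
    toward-new _ _ (is-old i) = toward-new-from-old q i
  ... | is-old j = record
    { at-target  = hᴴ-diag j
    ; off-target = λ x x≢old-j → toward-old x x≢old-j (newOrOld x) }
    where
    toward-old : ∀ x → x ≢ old j → NewOrOld x → Δ ⟦ H ⟧ (λ z → glued z (old j)) x ≡ deg H x
    toward-old _ _ (is-new p) = toward-old-from-new j p
    toward-old _ x≢ (is-old i) = toward-old-from-old (x≢ ∘ cong old)

  targetSum-glued : targetSum H glued (old v)
                    ≡ sum (λ q → (deg E q + 1ℚ) * σ q) + ((1ℚ + κ) * targetSum A h v + κ * sum (λ j → deg A j * h j v))
  targetSum-glued = begin
    targetSum H glued (old v)
      ≡⟨ ∑-split (λ y → deg H y * glued (old v) y) ⟩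
    sum (λ q → deg H (new q) * glued (old v) (new q)) + sum (λ j → deg H (old j) * hᴴ v j)
      ≡⟨ cong₂ _+_ (sum-cong-≗ (λ q → cong₂ _*_ (deg-new q) (from-v q)))
                   (trans (sum-cong-≗ (λ j → cong (_* hᴴ v j) (deg-old j))) (∑-point-mass v (ℤ.+ 3 / 1) (deg A) (hᴴ v))) ⟩
    sum (λ q → (deg E q + 1ℚ) * σ q) + (ℤ.+ 3 / 1 * hᴴ v v + sum (λ j → deg A j * hᴴ v j))
      ≡⟨ cong (λ x → sum (λ q → (deg E q + 1ℚ) * σ q) + (ℤ.+ 3 / 1 * x + sum (λ j → deg A j * hᴴ v j))) (hᴴ-diag v) ⟩
    sum (λ q → (deg E q + 1ℚ) * σ q) + (0ℚ + sum (λ j → deg A j * hᴴ v j))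
      ≡⟨ cong (sum (λ q → (deg E q + 1ℚ) * σ q) +_) (trans (+-identityˡ _) row-v) ⟩
    sum (λ q → (deg E q + 1ℚ) * σ q) + ((1ℚ + κ) * targetSum A h v + κ * sum (λ j → deg A j * h j v)) ∎
    where
    from-v : ∀ q → glued (old v) (new q) ≡ σ q
    from-v q = trans (glued-old-new v q) (trans (cong (_+ σ q) (h-diag v)) (+-identityˡ (σ q)))
    expand : ∀ d a κ x y → d * (a * x + (- κ) * 0ℚ + κ * y) ≡ a * (d * x) + κ * (d * y)
    expand = solve-∀ ℚ-ring
    row-v : sum (λ j → deg A j * hᴴ v j) ≡ (1ℚ + κ) * targetSum A h v + κ * sum (λ j → deg A j * h j v)
    row-v = begin
      sum (λ j → deg A j * hᴴ v j)
        ≡⟨ sum-cong-≗ (λ j → trans (cong (λ x → deg A j * ((1ℚ + κ) * h v j + (- κ) * x + κ * h j v)) (h-diag v))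
                                   (expand (deg A j) (1ℚ + κ) κ (h v j) (h j v))) ⟩
      sum (λ j → (1ℚ + κ) * (deg A j * h v j) + κ * (deg A j * h j v))
        ≡⟨ ∑-distrib-+ (λ j → (1ℚ + κ) * (deg A j * h v j)) (λ j → κ * (deg A j * h j v)) ⟩
      sum (λ j → (1ℚ + κ) * (deg A j * h v j)) + sum (λ j → κ * (deg A j * h j v))
        ≡⟨ cong₂ _+_ (*-distribˡ-sum (1ℚ + κ) (λ j → deg A j * h v j)) (*-distribˡ-sum κ (λ j → deg A j * h j v)) ⟨
      (1ℚ + κ) * targetSum A h v + κ * sum (λ j → deg A j * h j v) ∎

  0<vol : 0ℚ < vol H
  0<vol = <-≤-trans (subst (0ℚ <_) (sym (deg-new zero)) (+-mono-≤-< (deg-nonNeg E zero) (positive⁻¹ 1ℚ)))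
                    (≤-sum (deg H) (deg-nonNeg H) (new zero))

  kemeny-formula : ∀ {m} → IsHittingTimes H m → ∀ i →
                   kemeny H m i * vol H
                   ≡ sum (λ q → (deg E q + 1ℚ) * σ q) + ((1ℚ + κ) * targetSum A h v + κ * sum (λ j → deg A j * h j v))
  kemeny-formula m-hit i =
    trans (kemeny-targetSum (attach-connected conn) (attach-symmetric E-sym A-sym) 0<vol m-hit glued-hitting i (old v))
          targetSum-glued

-- The two graphs

decide-all : ∀ {f g : Fin 3 → ℚ} {ok : True (all? λ q → f q ℚ.≟ g q)} → ∀ q → f q ≡ g q
decide-all {ok = ok} = toWitness ok

decide-off-diagonal : ∀ {f g : Fin 3 → Fin 3 → ℚ}
                      {ok : True (all? λ p → all? λ q → ¬? (p ≟ q) →-dec (f p q ℚ.≟ g p q))} →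
                      ∀ p q → p ≢ q → f p q ≡ g p q
decide-off-diagonal {ok = ok} = toWitness ok

abEdgeGadget : Gadget abEdge
abEdgeGadget = record
  { τ = τ ; σ₀ = σ₀ ; σ₁ = σ₁ ; ρ₀ = ρ₀ ; ρ₁ = ρ₁
  ; τ-eq = decide-all ; σ₀-eq = decide-all ; σ₁-eq = decide-all
  ; ρ₀-eq = decide-off-diagonal ; ρ₁-eq = decide-off-diagonal
  ; ρ₀-diag = decide-all ; ρ₁-diag = decide-all
  }
  where
  τ σ₀ σ₁ : Fin 3 → ℚ
  τ zero = ℤ.+ 2 / 1
  τ (suc zero) = ℤ.+ 2 / 1
  τ (suc (suc zero)) = 1ℚ
  σ₀ (suc (suc zero)) = ℤ.+ 7 / 1
  σ₀ _ = ℤ.+ 10 / 3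
  σ₁ (suc (suc zero)) = 1ℚ
  σ₁ _ = ℤ.+ 2 / 3
  ρ₀ ρ₁ : Fin 3 → Fin 3 → ℚ
  ρ₀ zero (suc zero) = ℤ.+ 8 / 3
  ρ₀ (suc zero) zero = ℤ.+ 8 / 3
  ρ₀ zero (suc (suc zero)) = ℤ.+ 9 / 1
  ρ₀ (suc zero) (suc (suc zero)) = ℤ.+ 9 / 1
  ρ₀ (suc (suc zero)) zero = ℤ.+ 13 / 3
  ρ₀ (suc (suc zero)) (suc zero) = ℤ.+ 13 / 3
  ρ₀ _ _ = 0ℚ
  ρ₁ zero (suc zero) = ℤ.+ 1 / 3
  ρ₁ (suc zero) zero = ℤ.+ 1 / 3
  ρ₁ zero (suc (suc zero)) = 1ℚ
  ρ₁ (suc zero) (suc (suc zero)) = 1ℚ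
  ρ₁ (suc (suc zero)) zero = ℤ.+ 2 / 3
  ρ₁ (suc (suc zero)) (suc zero) = ℤ.+ 2 / 3
  ρ₁ _ _ = 0ℚ

abEdge-sym : IsSymmetric abEdge
abEdge-sym = toWitness {a? = all? λ p → all? λ q → abEdge p q Bool.≟ abEdge q p} _

triangleGadget : Gadget triangle
triangleGadget = record
  { τ = λ _ → ℤ.+ 3 / 1 ; σ₀ = λ _ → ℤ.+ 3 / 1 ; σ₁ = λ _ → ℤ.+ 1 / 2
  ; ρ₀ = off-diagonal (ℤ.+ 3 / 1) ; ρ₁ = off-diagonal (ℤ.+ 1 / 4)
  ; τ-eq = decide-all ; σ₀-eq = decide-all ; σ₁-eq = decide-all
  ; ρ₀-eq = decide-off-diagonal ; ρ₁-eq = decide-off-diagonal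
  ; ρ₀-diag = decide-all ; ρ₁-diag = decide-all
  }
  where
  off-diagonal : ℚ → Fin 3 → Fin 3 → ℚ
  off-diagonal x p q = if ⌊ p ≟ q ⌋ then 0ℚ else x

triangle-sym : IsSymmetric triangle
triangle-sym = toWitness {a? = all? λ p → all? λ q → triangle p q Bool.≟ triangle q p} _

<ᵇ-true : ∀ {m n} → m ℕ.< n → (m <ᵇ n) ≡ true
<ᵇ-true m<n = Equivalence.to T-≡ (ℕ.<⇒<ᵇ m<n)

<ᵇ-false : ∀ {m n} → ¬ (m ℕ.< n) → (m <ᵇ n) ≡ false
<ᵇ-false {m} {n} m≮n = ¬-not (λ eq → m≮n (ℕ.<ᵇ⇒< m n (Equivalence.from T-≡ eq)))

edge-split : ∀ {n} (G : SimpleGraph n) i j →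
             𝟙 (adj G i j) ≡ 𝟙 (adj G i j ∧ (toℕ i <ᵇ toℕ j)) + 𝟙 (adj G j i ∧ (toℕ j <ᵇ toℕ i))
edge-split G i j with ℕ.<-cmp (toℕ i) (toℕ j)
... | tri< i<j _ j≮i rewrite <ᵇ-true i<j | <ᵇ-false j≮i | ∧-identityʳ (adj G i j) | ∧-zeroʳ (adj G j i) =
  sym (+-identityʳ (𝟙 (adj G i j)))
... | tri> i≮j _ j<i rewrite <ᵇ-false i≮j | <ᵇ-true j<i | ∧-zeroʳ (adj G i j) | ∧-identityʳ (adj G j i) =
  trans (cong 𝟙 (SimpleGraph.sym G i j)) (sym (+-identityˡ (𝟙 (adj G j i))))
... | tri≈ i≮j i≡j j≮i rewrite <ᵇ-false i≮j | <ᵇ-false j≮i | ∧-zeroʳ (adj G i j) | ∧-zeroʳ (adj G j i) =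
  cong 𝟙 (trans (cong (adj G i) (sym (toℕ-injective i≡j))) (SimpleGraph.irrefl G i))

edgeCount≡ : ∀ {n} (A : Adj n) → toℚ (edgeCount A) ≡ sum (λ i → sum (λ j → 𝟙 (A i j ∧ (toℕ i <ᵇ toℕ j))))
edgeCount≡ A = trans (toℚ-Σℕ (λ i → Σℕ (count i)))
                     (sum-cong-≗ (λ i → trans (toℚ-Σℕ (count i)) (sum-cong-≗ (λ j → toℚ-if (A i j ∧ (toℕ i <ᵇ toℕ j))))))
  where
  count : _ → _ → ℕ
  count i j = if A i j ∧ (toℕ i <ᵇ toℕ j) then 1 else 0

vol≡2·edgeCount : ∀ {n} (G : SimpleGraph n) → vol (adj G) ≡ toℚ (edgeCount (adj G)) + toℚ (edgeCount (adj G))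
vol≡2·edgeCount G = begin
  sum (λ i → sum (λ j → 𝟙 (adj G i j)))
    ≡⟨ sum-cong-≗ (λ i → trans (sum-cong-≗ (edge-split G i)) (∑-distrib-+ (X i) (λ j → X j i))) ⟩
  sum (λ i → sum (X i) + sum (λ j → X j i))
    ≡⟨ ∑-distrib-+ (λ i → sum (X i)) (λ i → sum (λ j → X j i)) ⟩
  sum (λ i → sum (X i)) + sum (λ i → sum (λ j → X j i))
    ≡⟨ cong (sum (λ i → sum (X i)) +_) (∑-comm (λ i j → X j i)) ⟩
  sum (λ i → sum (X i)) + sum (λ j → sum (λ i → X j i))
    ≡⟨ cong₂ _+_ (edgeCount≡ (adj G)) (edgeCount≡ (adj G)) ⟨
  toℚ (edgeCount (adj G)) + toℚ (edgeCount (adj G)) ∎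
  where
  open ≡-Reasoning
  X : _ → _ → ℚ
  X i j = 𝟙 (adj G i j ∧ (toℕ i <ᵇ toℕ j))

vol≥8 : ∀ {n} (G : SimpleGraph n) → 4 ℕ.≤ edgeCount (adj G) → ℤ.+ 8 / 1 ≤ vol (adj G)
vol≥8 G 4≤e = subst (ℤ.+ 8 / 1 ≤_) (sym (vol≡2·edgeCount G)) (+-mono-≤ four≤ four≤)
  where
  four≤ : ℤ.+ 4 / 1 ≤ toℚ (edgeCount (adj G))
  four≤ = subst (λ e → ℤ.+ 4 / 1 ≤ toℚ e) (ℕ.m+[n∸m]≡n 4≤e)
            (subst (ℤ.+ 4 / 1 ≤_) (sym (toℚ-+ 4 rest))
              (subst (_≤ ℤ.+ 4 / 1 + toℚ rest) (+-identityʳ (ℤ.+ 4 / 1)) (+-monoʳ-≤ (ℤ.+ 4 / 1) (toℚ-nonNeg rest))))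
    where
    rest : ℕ
    rest = edgeCount (adj G) ℕ.∸ 4

eliminate-κ : ∀ K W Φ t κ c S → κ * W ≡ c → K * (W + c) ≡ S + ((1ℚ + κ) * Φ + κ * t) →
                K * (W + c) * W ≡ S * W + Φ * (W + c) + c * t
eliminate-κ K W Φ t κ c S κW≡c K-eq = begin
  K * (W + c) * W                                   ≡⟨ cong (_* W) K-eq ⟩
  (S + ((1ℚ + κ) * Φ + κ * t)) * W                  ≡⟨ expand S W Φ t κ ⟩
  S * W + Φ * (W + κ * W) + κ * W * t               ≡⟨ cong (λ x → S * W + Φ * (W + x) + x * t) κW≡c ⟩
  S * W + Φ * (W + c) + c * t                       ∎
  where
  open ≡-Reasoning
  expand : ∀ S W Φ t κ → (S + ((1ℚ + κ) * Φ + κ * t)) * W ≡ S * W + Φ * (W + κ * W) + κ * W * t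
  expand = solve-∀ ℚ-ring

kemeny-gap : ∀ {K₁ K₂ W Φ t κ₁ κ₂} → ℤ.+ 8 / 1 ≤ W → 0ℚ ≤ t →
             κ₁ * W ≡ ℤ.+ 8 / 1 → κ₂ * W ≡ ℤ.+ 12 / 1 →
             K₁ * (W + ℤ.+ 8 / 1) ≡ (ℤ.+ 11 / 3 * W + ℤ.+ 61 / 3) + ((1ℚ + κ₁) * Φ + κ₁ * t) →
             K₂ * (W + ℤ.+ 12 / 1) ≡ (ℤ.+ 9 / 2 * W + ℤ.+ 27 / 1) + ((1ℚ + κ₂) * Φ + κ₂ * t) →
             K₁ < K₂
kemeny-gap {K₁} {K₂} {W} {Φ} {t} {κ₁} {κ₂} 8≤W 0≤t κ₁W κ₂W K₁-eq K₂-eq =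
  *-cancelʳ-<-nonNeg C {{nonNegative (<⇒≤ 0<C)}} (0<q-p⇒p<q (subst (0ℚ <_) (sym gap) 0<D))
  where
  0<W : 0ℚ < W
  0<W = <-≤-trans (positive⁻¹ (ℤ.+ 8 / 1)) 8≤W
  C : ℚ
  C = (W + ℤ.+ 8 / 1) * (W + ℤ.+ 12 / 1) * W
  0<C : 0ℚ < C
  0<C = *-pos (*-pos (+-mono-<-≤ 0<W (nonNegative⁻¹ (ℤ.+ 8 / 1))) (+-mono-<-≤ 0<W (nonNegative⁻¹ (ℤ.+ 12 / 1))))
              0<W
  -- Φ / W enters both constants with coefficient one and cancels; what remains is positive once W ≥ 8.
  D : ℚ
  D = W * ((W - ℤ.+ 8 / 1) * (ℤ.+ 5 / 1 * W + ℤ.+ 32 / 1) + ℤ.+ 88 / 1) * (ℤ.+ 1 / 6) + ℤ.+ 4 / 1 * W * t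
  0<D : 0ℚ < D
  0<D = +-mono-<-≤ (*-pos (*-pos 0<W 0<quadratic) (positive⁻¹ (ℤ.+ 1 / 6)))
                   (*-nonNeg (*-nonNeg (nonNegative⁻¹ (ℤ.+ 4 / 1)) (<⇒≤ 0<W)) 0≤t)
    where
    0<quadratic : 0ℚ < (W - ℤ.+ 8 / 1) * (ℤ.+ 5 / 1 * W + ℤ.+ 32 / 1) + ℤ.+ 88 / 1
    0<quadratic = +-mono-≤-< (*-nonNeg (p≤q⇒0≤q-p 8≤W)
                                       (+-mono-≤ (*-nonNeg (nonNegative⁻¹ (ℤ.+ 5 / 1)) (<⇒≤ 0<W)) (nonNegative⁻¹ (ℤ.+ 32 / 1))))
                             (positive⁻¹ (ℤ.+ 88 / 1))
  regroupˡ : ∀ K W a b → K * ((W + a) * (W + b) * W) ≡ K * (W + a) * W * (W + b)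
  regroupˡ = solve-∀ ℚ-ring
  regroupʳ : ∀ K W a b → K * ((W + a) * (W + b) * W) ≡ K * (W + b) * W * (W + a)
  regroupʳ = solve-∀ ℚ-ring
  difference : ∀ W Φ t →
    ((ℤ.+ 9 / 2 * W + ℤ.+ 27 / 1) * W + Φ * (W + ℤ.+ 12 / 1) + ℤ.+ 12 / 1 * t) * (W + ℤ.+ 8 / 1)
    - ((ℤ.+ 11 / 3 * W + ℤ.+ 61 / 3) * W + Φ * (W + ℤ.+ 8 / 1) + ℤ.+ 8 / 1 * t) * (W + ℤ.+ 12 / 1)
    ≡ W * ((W - ℤ.+ 8 / 1) * (ℤ.+ 5 / 1 * W + ℤ.+ 32 / 1) + ℤ.+ 88 / 1) * (ℤ.+ 1 / 6) + ℤ.+ 4 / 1 * W * t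
  difference = solve-∀ ℚ-ring
  gap : K₂ * C - K₁ * C ≡ D
  gap = begin
    K₂ * C - K₁ * C
      ≡⟨ cong₂ _-_ (regroupʳ K₂ W (ℤ.+ 8 / 1) (ℤ.+ 12 / 1)) (regroupˡ K₁ W (ℤ.+ 8 / 1) (ℤ.+ 12 / 1)) ⟩
    K₂ * (W + ℤ.+ 12 / 1) * W * (W + ℤ.+ 8 / 1) - K₁ * (W + ℤ.+ 8 / 1) * W * (W + ℤ.+ 12 / 1)
      ≡⟨ cong₂ (λ x y → x * (W + ℤ.+ 8 / 1) - y * (W + ℤ.+ 12 / 1))
                   (eliminate-κ K₂ W Φ t κ₂ (ℤ.+ 12 / 1) (ℤ.+ 9 / 2 * W + ℤ.+ 27 / 1) κ₂W K₂-eq)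
                   (eliminate-κ K₁ W Φ t κ₁ (ℤ.+ 8 / 1) (ℤ.+ 11 / 3 * W + ℤ.+ 61 / 3) κ₁W K₁-eq) ⟩
    ((ℤ.+ 9 / 2 * W + ℤ.+ 27 / 1) * W + Φ * (W + ℤ.+ 12 / 1) + ℤ.+ 12 / 1 * t) * (W + ℤ.+ 8 / 1)
    - ((ℤ.+ 11 / 3 * W + ℤ.+ 61 / 3) * W + Φ * (W + ℤ.+ 8 / 1) + ℤ.+ 8 / 1 * t) * (W + ℤ.+ 12 / 1)
      ≡⟨ difference W Φ t ⟩
    D ∎
    where open ≡-Reasoning

module Comparison {n} (G : SimpleGraph n) (conn : Connected (adj G)) (v : Fin n) (8≤W : ℤ.+ 8 / 1 ≤ vol (adj G)) where

  A : Adj n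
  A = adj G

  W : ℚ
  W = vol A

  instance
    W-positive : Positive W
    W-positive = positive (<-≤-trans (positive⁻¹ (ℤ.+ 8 / 1)) 8≤W)
    W≢0 : NonZero W
    W≢0 = pos⇒nonZero W

  κ : ℚ → ℚ
  κ c = c * 1/ W

  κ-eq : ∀ c → κ c * W ≡ c
  κ-eq c = trans (*-assoc c (1/ W) W) (trans (cong (c *_) (*-inverseˡ W)) (*-identityʳ c))

  h : Fin n → Fin n → ℚ
  h = proj₁ (hitting-matrix A conn)

  h-hit : IsHittingMatrix A h
  h-hit = proj₂ (hitting-matrix A conn)

  Φ t : ℚ
  Φ = targetSum A h v
  t = sum (λ j → deg A j * h j v)

  0≤t : 0ℚ ≤ t
  0≤t = sum-nonNeg _ (λ j → *-nonNeg (deg-nonNeg A j) (hitting-nonNeg (λ i → conn i v) (h-hit v) j))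

  kemeny-attached : ∀ {E} → IsSymmetric E → (g : Gadget E) → ∀ c a b →
                    sum (Gadget.τ g) + ℤ.+ 3 / 1 ≡ c → sum (λ p → deg E p + 1ℚ) + ℤ.+ 3 / 1 ≡ c →
                    sum (λ q → (deg E q + 1ℚ) * Gadget.σ₁ g q) ≡ a → sum (λ q → (deg E q + 1ℚ) * Gadget.σ₀ g q) ≡ b →
                    ∀ {m} → IsHittingTimes (attach A v E) m → ∀ i →
                    kemeny (attach A v E) m i * (W + c) ≡ (a * W + b) + ((1ℚ + κ c) * Φ + κ c * t)
  kemeny-attached {E} E-sym g c a b τ-sum vol-sum σ₁-sum σ₀-sum {m} m-hit i =
    subst₂ (λ V S → kemeny (attach A v E) m i * V ≡ S + ((1ℚ + κ c) * Φ + κ c * t)) vol-H σ-sum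
           (Glued.kemeny-formula (SimpleGraph.sym G) conn v E-sym g h-hit (κ c) (trans (κ-eq c) (sym τ-sum)) m-hit i)
    where
    rearrange : ∀ X W → X + (ℤ.+ 3 / 1 + W) ≡ W + (X + ℤ.+ 3 / 1)
    rearrange = solve-∀ ℚ-ring
    vol-H : vol (attach A v E) ≡ W + c
    vol-H = trans (Attach.vol-attach A v E) (trans (rearrange (sum (λ p → deg E p + 1ℚ)) W) (cong (W +_) vol-sum))
    σ-sum : sum (λ q → (deg E q + 1ℚ) * Gadget.σ g W q) ≡ a * W + b
    σ-sum = trans (Gadget.∑-weighted-σ g (λ q → deg E q + 1ℚ) W)
                  (trans (cong₂ (λ x y → x + y * W) σ₀-sum σ₁-sum) (+-comm b (a * W)))

  tilde<star : ∀ {mS mT} → IsHittingTimes (Gstar G v) mS → IsHittingTimes (Gtilde G v) mT →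
               ∀ i i′ → kemeny (Gtilde G v) mT i′ < kemeny (Gstar G v) mS i
  tilde<star mS-hit mT-hit i i′ =
    kemeny-gap {Φ = Φ} {κ₁ = κ (ℤ.+ 8 / 1)} {κ₂ = κ (ℤ.+ 12 / 1)} 8≤W 0≤t (κ-eq (ℤ.+ 8 / 1)) (κ-eq (ℤ.+ 12 / 1))
      (kemeny-attached abEdge-sym abEdgeGadget (ℤ.+ 8 / 1) (ℤ.+ 11 / 3) (ℤ.+ 61 / 3) refl refl refl refl mT-hit i′)
      (kemeny-attached triangle-sym triangleGadget (ℤ.+ 12 / 1) (ℤ.+ 9 / 2) (ℤ.+ 27 / 1) refl refl refl refl mS-hit i)

theorem4p14 : ∀ {n} (G : SimpleGraph n) → Connected (adj G) → 4 ℕ.≤ edgeCount (adj G) →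
    (v : Fin n) →
      (∃ λ m → IsHittingTimes (Gstar G v) m) ×
      (∃ λ m → IsHittingTimes (Gtilde G v) m) ×
      (∀ mS mT → IsHittingTimes (Gstar G v) mS → IsHittingTimes (Gtilde G v) mT →
        ∀ i i' → kemeny (Gtilde G v) mT i' < kemeny (Gstar G v) mS i)
theorem4p14 G conn 4≤e v =
    hitting-times-exist (Attach.attach-connected (adj G) v triangle conn)
  , hitting-times-exist (Attach.attach-connected (adj G) v abEdge conn)
  , λ _ _ → tilde<star
  where open Comparison G conn v (vol≥8 G 4≤e)
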